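{- Let $g,n\ge0$ with $3g-3+n>0$, and let $(\mathbf G,\tau)$ be an edge-labelled pair with $b^1(\mathbf G)=g$. If $(\mathbf G',\tau')$ is an edge-labelled pair with $\mathcal D^{\mathbf G}_\tau\cong\mathcal D^{\mathbf G'}_{\tau'}$ and $\mathcal Q^{\mathbf G}_\tau=\mathcal Q^{\mathbf G'}_{\tau'}$, then $(\mathbf G,\tau)\cong(\mathbf G',\tau')$.
   Context: $I_n=\{1,\dots,n\}$; $[p]=\{0,\dots,p\}$. A graph $G$ is a finite set $X(G)=V(G)\sqcup H(G)$ with maps $s,r$ ($s^2=\mathrm{id}$, $r^2=r$, both with fixed-point set $V(G)$); $r$ gives the vertex of a half-edge, edges are $s$-orbits in $H(G)$ (loops, multiple edges allowed); graphs are connected, $b^1(G)=|E|-|V|+1$, $\mathrm{val}(v)$ = number of half-edges at $v$. A stable $n$-marked weighted graph of genus $g$ is $\mathbf G=(G,w,m)$, $w:V\to\mathbb Z_{\ge0}$, $m:I_n\to V$, with $b^1(G)+\sum w(v)=g$ and $2w(v)-2+\mathrm{val}(v)+|m^{ -1}(v)|>0$ for all $v$; isomorphisms preserve $r,s,w,m$. Contracting a loop deletes it and adds 1 to its vertex weight; contracting a non-loop edge merges its endpoints (weights summed, markings united). An edge-labelled pair $(\mathbf G,\tau)$ is such a graph with a bijection $\tau:E(\mathbf G)\to[p]$; pairs are isomorphic if an isomorphism carries the edge labelled $i$ to the edge labelled $i$ for all $i$. For $j\in[p]$ let $e_j=\tau^{ -1}(j)$ and $(\mathbf G/e_j,\tau_j)$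 the contraction of $e_j$, relabelled by the order-preserving bijection $[p]\smallsetminus\{j\}\to[p-1]$. The nonloop contraction deck $\mathcal D^{\mathbf G}_\tau$ is the indexed list $\{((\mathbf G/e_j,\tau_j),j): e_j\text{ not a loop}\}$; two lists are equivalent ($\cong$) if they have the same index set and isomorphic pairs at each index. For $\alpha,\beta\in[p]\sqcup I_n$, $\langle\alpha,\beta\rangle^{\mathbf G}_\tau\in\{0,1,2\}$ is the number of vertices shared by the corresponding objects, where an edge index $i$ corresponds to $e_i$, a marking $x$ is treated like a loop at the vertex $m(x)$, a loop meets itself at one vertex and a non-loop edge meets itself at two vertices. The intersection matrix $\mathcal Q^{\mathbf G}_\tau$ is the symmetric matrix $(\langle\alpha,\beta\rangle^{\mathbf G}_\tau)_{\alpha,\beta\in[p]\sqcup I_n}$ with both index sets ordered naturally. -}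

module Defs where

open import Data.Nat using (ℕ; zero; suc; _+_; _*_; _∸_; _≤_; _<_; _<ᵇ_; ⌊_/2⌋)
import Data.Nat as ℕ
open import Data.Fin using (Fin; zero; suc; toℕ)
open import Data.Fin.Properties using (_≟_)
open import Data.Bool using (Bool; true; false; _∧_; _∨_; not; if_then_else_; T)
open import Data.Maybe using (Maybe; just; nothing)
open import Data.Product using (Σ; ∃; _×_; _,_)
open import Data.Sum using (_⊎_)
import Data.Integer as ℤ
open import Relation.Nullary.Decidable using (⌊_⌋)
open import Relation.Binary.PropositionalEquality using (_≡_)
open import Relation.Binary.Construct.Closure.Equivalence using (EqClosure)

sumF : ∀ {N} → (Fin N → ℕ) → ℕ
sumF {zero}  f = 0
sumF {suc N} f = f zero + sumF (λ x → f (suc x))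

countF : ∀ {N} → (Fin N → Bool) → ℕ
countF f = sumF (λ x → if f x then 1 else 0)

anyF : ∀ {N} → (Fin N → Bool) → Bool
anyF {zero}  f = false
anyF {suc N} f = f zero ∨ anyF (λ x → f (suc x))

findF : ∀ {N} → (Fin N → Bool) → Maybe (Fin N)
findF {zero}  f = nothing
findF {suc N} f with f zero
... | true  = just zero
... | false with findF (λ x → f (suc x))
...   | just x  = just (suc x)
...   | nothing = nothing

_==_ : ∀ {N} → Fin N → Fin N → Bool
x == y = ⌊ x ≟ y ⌋

_==ℕ_ : ℕ → ℕ → Bool
a ==ℕ b = ⌊ a ℕ.≟ b ⌋

-- Raw data of an n-marked weighted graph with an edge labelling by
-- [p] = {0,…,p}, where k = p+1 is the number of edges.
--
-- The finite set X(G) is presented as the subset {x | present x} of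
-- Fin N.  s, r are the two structure maps, w the vertex weights, m the
-- marking, τ h the label of the edge (s-orbit) containing half-edge h.
-- Values of s, r, w, τ outside the relevant subsets are irrelevant.

record Pair (n k : ℕ) : Set where
  field
    N       : ℕ
    present : Fin N → Bool
    s r     : Fin N → Fin N
    w       : Fin N → ℕ
    m       : Fin n → Fin N
    τ       : Fin N → ℕ

module _ {n k : ℕ} (G : Pair n k) where
  open Pair G

  In : Fin N → Set
  In x = T (present x)

  isVᵇ isHᵇ : Fin N → Bool
  isVᵇ x = present x ∧ (r x == x)
  isHᵇ x = present x ∧ not (r x == x)

  IsVertex IsHalf : Fin N → Set
  IsVertex x = T (isVᵇ x)
  IsHalf x = T (isHᵇ x)

  #V #H #E : ℕ
  #V = countF isVᵇ
  #H = countF isHᵇ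
  #E = ⌊ #H /2⌋            -- edges are the 2-element s-orbits in H

  b1 : ℤ.ℤ
  b1 = (ℤ.+ #E ℤ.- ℤ.+ #V) ℤ.+ ℤ.+ 1

  totalWeight : ℕ
  totalWeight = sumF (λ x → if isVᵇ x then w x else 0)

  val : Fin N → ℕ
  val v = countF (λ h → isHᵇ h ∧ (r h == v))

  #marks : Fin N → ℕ
  #marks v = countF (λ i → m i == v)

  Step : Fin N → Fin N → Set
  Step x y = In x × (r x ≡ y ⊎ s x ≡ y)

  NonLoop : ℕ → Set
  NonLoop j = ∃ λ h → IsHalf h × τ h ≡ j × (r h ≡ r (s h) → Data.Empty.⊥)
    where import Data.Empty

  incident : Fin k ⊎ Fin n → Fin N → Bool
  incident (_⊎_.inj₁ i) v = anyF (λ h → isHᵇ h ∧ (τ h ==ℕ toℕ i) ∧ (r h == v))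
  incident (_⊎_.inj₂ x) v = m x == v

  ⟨_,_⟩ : Fin k ⊎ Fin n → Fin k ⊎ Fin n → ℕ
  ⟨ α , β ⟩ = countF (λ v → isVᵇ v ∧ incident α v ∧ incident β v)

𝒬 : ∀ {n k} → Pair n k → Fin k ⊎ Fin n → Fin k ⊎ Fin n → ℕ
𝒬 G α β = ⟨_,_⟩ G α β

record IsStablePair (g : ℕ) {n k : ℕ} (G : Pair n k) : Set where
  open Pair G
  field
    s-closed  : ∀ x → In G x → In G (s x)
    r-closed  : ∀ x → In G x → In G (r x)
    s-invol   : ∀ x → In G x → s (s x) ≡ x
    r-idem    : ∀ x → In G x → r (r x) ≡ r x
    fix-s⇒r   : ∀ x → In G x → s x ≡ x → r x ≡ x
    fix-r⇒s   : ∀ x → In G x → r x ≡ x → s x ≡ x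
    nonempty  : ∃ λ x → In G x
    connected : ∀ x y → In G x → In G y → EqClosure (Step G) x y
    m-vertex  : ∀ i → IsVertex G (m i)
    genus     : b1 G ℤ.+ ℤ.+ totalWeight G ≡ ℤ.+ g
    stable    : ∀ v → IsVertex G v → 3 ≤ 2 * w v + val G v + #marks G v
    -- τ : E(G) → [p] is a bijection (k = p+1)
    τ-range   : ∀ h → IsHalf G h → τ h < k
    τ-orbit   : ∀ h → IsHalf G h → τ (s h) ≡ τ h
    τ-inj     : ∀ h h' → IsHalf G h → IsHalf G h' → τ h ≡ τ h' → h' ≡ h ⊎ h' ≡ s h
    τ-surj    : ∀ j → j < k → ∃ λ h → IsHalf G h × τ h ≡ j

record _≅_ {n k : ℕ} (G G' : Pair n k) : Set where
  private
    module A = Pair G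
    module B = Pair G'
  field
    φ : Fin A.N → Fin B.N
    ψ : Fin B.N → Fin A.N
    φ-In   : ∀ x → In G x → In G' (φ x)
    ψ-In   : ∀ y → In G' y → In G (ψ y)
    ψφ     : ∀ x → In G x → ψ (φ x) ≡ x
    φψ     : ∀ y → In G' y → φ (ψ y) ≡ y
    φ-s    : ∀ x → In G x → φ (A.s x) ≡ B.s (φ x)
    φ-r    : ∀ x → In G x → φ (A.r x) ≡ B.r (φ x)
    φ-w    : ∀ x → IsVertex G x → B.w (φ x) ≡ A.w x
    φ-m    : ∀ i → φ (A.m i) ≡ B.m i
    φ-τ    : ∀ h → IsHalf G h → B.τ (φ h) ≡ A.τ h

-- Contraction of the edge e_j (for a non-loop edge), with labels
-- relabelled by the order-preserving bijection [p]∖{j} → [p-1].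

relabel : ℕ → ℕ → ℕ
relabel j t = if t <ᵇ j then t else t ∸ 1

contract : ∀ {n p} → Pair n (suc p) → Fin (suc p) → Pair n p
contract {n} {p} G j with findF (λ x → isHᵇ G x ∧ (Pair.τ G x ==ℕ toℕ j))
... | nothing = record { N = N ; present = present ; s = s ; r = r ; w = w ; m = m
                       ; τ = λ x → relabel (toℕ j) (τ x) }
  where open Pair G
... | just h = record
  { N       = N
  ; present = λ x → present x ∧ not ((x == h) ∨ (x == s h) ∨ (x == v))
  ; s       = s
  ; r       = λ x → merge (r x)
  ; w       = λ x → if x == u then w u + w v else w x
  ; m       = λ i → merge (m i)
  ; τ       = λ x → relabel (toℕ j) (τ x)
  }
  where
  open Pair G
  u v : Fin N
  u = r h
  v = r (s h)
  merge : Fin N → Fin N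
  merge y = if y == v then u else y

DeckEquiv : ∀ {n p} → Pair n (suc p) → Pair n (suc p) → Set
DeckEquiv G G' = ∀ j →
    (NonLoop G (toℕ j) → NonLoop G' (toℕ j))
  × (NonLoop G' (toℕ j) → NonLoop G (toℕ j))
  × (NonLoop G (toℕ j) → contract G j ≅ contract G' j)

-- Since b¹(G) = g, every vertex weight is 0, so an isomorphism G ≅ G' is determined by a bijection β
-- of the vertices preserving every incidence of an edge or a marking with a vertex: the half-edges
-- are then matched label by label, the diagonal entry 𝒬(t,t) ∈ {1, 2} telling loops from non-loops,
-- and the weights of G' vanish as well because β and the matching force b¹(G') = b¹(G).
-- If G has only loops, so has G' (its deck sees every non-loop), and by connectivity both have a
-- single vertex. Otherwise contract a non-loop edge e = uv of G and the edge u'v' of G' with the same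
-- label. The deck isomorphism of the contractions gives β off {u, v}, because row e of 𝒬 tells which
-- objects meet {u, v}, that is, the merged vertex. On the endpoints, 𝒬(α,γ) minus the part already
-- matched off {u, v} is [u ∈ α ∩ γ] + [v ∈ α ∩ γ], and these overlaps determine the incidences at
-- u, v from those at u', v' up to one global exchange of u' and v'.

module Submission where

open import Defs
open import Data.Nat using (ℕ; zero; suc; _+_; _*_; _≤_; _<_; _<ᵇ_; z≤n; s≤s)
import Data.Nat.Properties as ℕₚ
open import Data.Fin using (Fin; zero; suc; toℕ; fromℕ<)
open import Data.Fin.Properties using (_≟_; suc-injective; toℕ<n; toℕ-fromℕ<; toℕ-injective)
open import Data.Bool using (Bool; true; false; _∧_; _∨_; not; _xor_; if_then_else_; T)
open import Data.Bool.Properties using (T-≡; ∧-identityʳ; ∧-zeroʳ; ∧-idem; not-involutive; ⇔→≡; if-float)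
open import Data.Maybe using (Maybe; just; nothing)
open import Data.Product using (∃; _×_; _,_; proj₁; proj₂; swap)
open import Data.Sum using (_⊎_; inj₁; inj₂; [_,_])
open import Data.Sum.Properties using (≡-dec)
open import Data.Empty using (⊥; ⊥-elim)
open import Data.Integer using (+_)
import Data.Integer as ℤ
import Data.Integer.Properties as ℤₚ
open import Algebra.Properties.AbelianGroup ℤₚ.+-0-abelianGroup using (∙-cancelˡ)
open import Function.Bundles using (_⇔_; mk⇔; Equivalence)
open import Function.Properties.Equivalence using () renaming (refl to ⇔-refl; sym to ⇔-sym; trans to ⇔-trans)
open import Relation.Nullary using (¬_; Dec; yes; no)
open import Relation.Nullary.Decidable using (isYes≗does; dec-true; dec-false; toWitness)
open import Relation.Binary.PropositionalEquality hiding ([_])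
open import Relation.Binary.Construct.Closure.Equivalence using (EqClosure)
open import Relation.Binary.Construct.Closure.ReflexiveTransitive using (ε; _◅_)
open import Relation.Binary.Construct.Closure.Symmetric using (fwd; bwd)

==-refl : ∀ {N} (x : Fin N) → (x == x) ≡ true
==-refl x = trans (isYes≗does (x ≟ x)) (dec-true (x ≟ x) refl)

==⇒≡ : ∀ {N} {x y : Fin N} → (x == y) ≡ true → x ≡ y
==⇒≡ e = toWitness (Equivalence.from T-≡ e)

≢⇒==-false : ∀ {N} {x y : Fin N} → ¬ x ≡ y → (x == y) ≡ false
≢⇒==-false {x = x} {y} x≢y = trans (isYes≗does (x ≟ y)) (dec-false (x ≟ y) x≢y)

==-false⇒≢ : ∀ {N} {x y : Fin N} → (x == y) ≡ false → ¬ x ≡ y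
==-false⇒≢ {x = x} e refl with () ← trans (sym (==-refl x)) e

==ℕ-refl : ∀ a → (a ==ℕ a) ≡ true
==ℕ-refl a = trans (isYes≗does (a ℕₚ.≟ a)) (dec-true (a ℕₚ.≟ a) refl)

==ℕ⇒≡ : ∀ {a b} → (a ==ℕ b) ≡ true → a ≡ b
==ℕ⇒≡ e = toWitness (Equivalence.from T-≡ e)

∧-elim : ∀ {a b} → (a ∧ b) ≡ true → a ≡ true × b ≡ true
∧-elim {true} {true} _ = refl , refl

∧-intro : ∀ {a b} → a ≡ true → b ≡ true → (a ∧ b) ≡ true
∧-intro refl refl = refl

∨-elim : ∀ {a b} → (a ∨ b) ≡ true → a ≡ true ⊎ b ≡ true
∨-elim {true} _ = inj₁ refl
∨-elim {false} {true} _ = inj₂ refl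

∨-intro : ∀ {a b} → a ≡ true ⊎ b ≡ true → (a ∨ b) ≡ true
∨-intro {true} _ = refl
∨-intro {false} (inj₂ b) = b

∨-false-elim : ∀ {a b} → (a ∨ b) ≡ false → a ≡ false × b ≡ false
∨-false-elim {false} {false} _ = refl , refl

not≡true : ∀ {a} → not a ≡ true → a ≡ false
not≡true {false} _ = refl

not≡false : ∀ {a} → a ≡ false → not a ≡ true
not≡false refl = refl

¬true⇒false : ∀ {a} → ¬ a ≡ true → a ≡ false
¬true⇒false {false} _ = refl
¬true⇒false {true} a≢true = ⊥-elim (a≢true refl)

true≢false : ∀ {a} → a ≡ true → a ≡ false → ⊥
true≢false refl ()

true⊎false : (a : Bool) → a ≡ true ⊎ a ≡ false
true⊎false true = inj₁ refl
true⊎false false = inj₂ refl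

T⇒≡true : ∀ {a} → T a → a ≡ true
T⇒≡true = Equivalence.to T-≡

≡true⇒T : ∀ {a} → a ≡ true → T a
≡true⇒T = Equivalence.from T-≡

ind : Bool → ℕ
ind b = if b then 1 else 0

sumF-cong : ∀ {N} {f g : Fin N → ℕ} → (∀ x → f x ≡ g x) → sumF f ≡ sumF g
sumF-cong {zero} f≗g = refl
sumF-cong {suc N} f≗g = cong₂ _+_ (f≗g zero) (sumF-cong (λ x → f≗g (suc x)))

sumF≡0⇒≡0 : ∀ {N} (f : Fin N → ℕ) → sumF f ≡ 0 → ∀ x → f x ≡ 0
sumF≡0⇒≡0 {suc N} f e zero = ℕₚ.m+n≡0⇒m≡0 (f zero) e
sumF≡0⇒≡0 {suc N} f e (suc x) = sumF≡0⇒≡0 (λ y → f (suc y)) (ℕₚ.m+n≡0⇒n≡0 (f zero) e) x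

countF-false : ∀ {N} (f : Fin N → Bool) → (∀ x → f x ≡ false) → countF f ≡ 0
countF-false {zero} f f≡false = refl
countF-false {suc N} f f≡false rewrite f≡false zero = countF-false (λ x → f (suc x)) (λ x → f≡false (suc x))

sumF-split : ∀ {N} (f : Fin N → ℕ) (a : Fin N) →
  sumF f ≡ f a + sumF (λ x → if x == a then 0 else f x)
sumF-split {suc N} f zero = cong (_+_ (f zero)) (sym (ℕₚ.+-identityˡ _))
sumF-split {suc N} f (suc a) = begin
    f zero + sumF (λ x → f (suc x))
  ≡⟨ cong (_+_ (f zero)) (sumF-split (λ x → f (suc x)) a) ⟩
    f zero + (f (suc a) + rest)
  ≡⟨ ℕₚ.+-comm (f zero) _ ⟩
    (f (suc a) + rest) + f zero
  ≡⟨ ℕₚ.+-assoc (f (suc a)) rest (f zero) ⟩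
    f (suc a) + (rest + f zero)
  ≡⟨ cong (_+_ (f (suc a))) (ℕₚ.+-comm rest (f zero)) ⟩
    f (suc a) + (f zero + rest)
  ≡⟨ cong (λ z → f (suc a) + (f zero + z)) (sumF-cong suc-case) ⟩
    f (suc a) + (f zero + sumF (λ x → if suc x == suc a then 0 else f (suc x)))
  ∎
  where
  open ≡-Reasoning
  rest = sumF (λ x → if x == a then 0 else f (suc x))
  suc-case : ∀ x → (if x == a then 0 else f (suc x)) ≡ (if suc x == suc a then 0 else f (suc x))
  suc-case x with x ≟ a
  ... | yes _ = refl
  ... | no _ = refl

countF-split : ∀ {N} (f : Fin N → Bool) (a : Fin N) →
  countF f ≡ ind (f a) + countF (λ x → f x ∧ not (x == a))
countF-split f a = trans (sumF-split _ a) (cong (_+_ (ind (f a))) (sumF-cong removed))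
  where
  removed : ∀ x → (if x == a then 0 else ind (f x)) ≡ ind (f x ∧ not (x == a))
  removed x with x == a | f x
  ... | true | true = refl
  ... | true | false = refl
  ... | false | true = refl
  ... | false | false = refl

countF-≤-inj : ∀ {N M} (f : Fin N → Bool) (g : Fin M → Bool) (φ : Fin N → Fin M) →
  (∀ x → f x ≡ true → g (φ x) ≡ true) →
  (∀ x y → f x ≡ true → f y ≡ true → φ x ≡ φ y → x ≡ y) →
  countF f ≤ countF g
countF-≤-inj {zero} f g φ φ-maps φ-inj = z≤n
countF-≤-inj {suc N} f g φ φ-maps φ-inj with f zero in f0
... | false = countF-≤-inj (λ x → f (suc x)) g (λ x → φ (suc x)) (λ x → φ-maps (suc x))
                (λ x y p q e → suc-injective (φ-inj (suc x) (suc y) p q e))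
... | true rewrite countF-split g (φ zero) | φ-maps zero f0 =
  s≤s (countF-≤-inj (λ x → f (suc x)) _ (λ x → φ (suc x))
        (λ x p → ∧-intro (φ-maps (suc x) p)
                         (not≡false (≢⇒==-false (λ e → 0≢suc (φ-inj (suc x) zero p f0 e)))))
        (λ x y p q e → suc-injective (φ-inj (suc x) (suc y) p q e)))
  where
  0≢suc : ∀ {x : Fin N} → ¬ Fin.suc x ≡ zero
  0≢suc ()

countF-≡-bij : ∀ {N M} (f : Fin N → Bool) (g : Fin M → Bool) (φ : Fin N → Fin M) (ψ : Fin M → Fin N) →
  (∀ x → f x ≡ true → g (φ x) ≡ true) →
  (∀ y → g y ≡ true → f (ψ y) ≡ true) →
  (∀ x → f x ≡ true → ψ (φ x) ≡ x) →
  (∀ y → g y ≡ true → φ (ψ y) ≡ y) →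
  countF f ≡ countF g
countF-≡-bij f g φ ψ φ-maps ψ-maps ψφ φψ = ℕₚ.≤-antisym
  (countF-≤-inj f g φ φ-maps (λ x y p q e → trans (sym (ψφ x p)) (trans (cong ψ e) (ψφ y q))))
  (countF-≤-inj g f ψ ψ-maps (λ x y p q e → trans (sym (φψ x p)) (trans (cong φ e) (φψ y q))))

countF-split₂ : ∀ {N} (f : Fin N → Bool) (a b : Fin N) → ¬ a ≡ b →
  countF f ≡ ind (f a) + (ind (f b) + countF (λ y → (f y ∧ not (y == a)) ∧ not (y == b)))
countF-split₂ f a b a≢b rewrite countF-split f a
  | countF-split (λ y → f y ∧ not (y == a)) b | ≢⇒==-false {x = b} {a} (λ e → a≢b (sym e))
  | ∧-identityʳ (f b) = refl

countF-supported₂ : ∀ {N} (f : Fin N → Bool) (a b : Fin N) → ¬ a ≡ b →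
  (∀ y → f y ≡ true → y ≡ a ⊎ y ≡ b) → countF f ≡ ind (f a) + ind (f b)
countF-supported₂ f a b a≢b supp = begin
    countF f
  ≡⟨ countF-split₂ f a b a≢b ⟩
    ind (f a) + (ind (f b) + countF (λ y → (f y ∧ not (y == a)) ∧ not (y == b)))
  ≡⟨ cong (λ z → ind (f a) + (ind (f b) + z)) (countF-false _ outside) ⟩
    ind (f a) + (ind (f b) + 0)
  ≡⟨ cong (_+_ (ind (f a))) (ℕₚ.+-identityʳ _) ⟩
    ind (f a) + ind (f b)
  ∎
  where
  open ≡-Reasoning
  outside : ∀ y → ((f y ∧ not (y == a)) ∧ not (y == b)) ≡ false
  outside y with f y in fy
  ... | false = refl
  ... | true with supp y fy
  ...   | inj₁ refl rewrite ==-refl a = refl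
  ...   | inj₂ refl rewrite ==-refl b = ∧-zeroʳ _

countF-supported₁ : ∀ {N} (f : Fin N → Bool) (a : Fin N) →
  (∀ y → f y ≡ true → y ≡ a) → countF f ≡ ind (f a)
countF-supported₁ f a supp = begin
    countF f
  ≡⟨ countF-split f a ⟩
    ind (f a) + countF (λ y → f y ∧ not (y == a))
  ≡⟨ cong (_+_ (ind (f a))) (countF-false _ outside) ⟩
    ind (f a) + 0
  ≡⟨ ℕₚ.+-identityʳ _ ⟩
    ind (f a)
  ∎
  where
  open ≡-Reasoning
  outside : ∀ y → (f y ∧ not (y == a)) ≡ false
  outside y with f y in fy
  ... | false = refl
  ... | true with supp y fy
  ...   | refl rewrite ==-refl a = refl

anyF-witness : ∀ {N} (f : Fin N → Bool) → anyF f ≡ true → ∃ λ x → f x ≡ true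
anyF-witness {suc N} f e with f zero in f0
... | true = zero , f0
... | false with anyF-witness (λ x → f (suc x)) e
...   | x , fx = suc x , fx

anyF-intro : ∀ {N} (f : Fin N → Bool) x → f x ≡ true → anyF f ≡ true
anyF-intro f zero e rewrite e = refl
anyF-intro {suc N} f (suc x) e with f zero
... | true = refl
... | false = anyF-intro (λ y → f (suc y)) x e

findF-sound : ∀ {N} (f : Fin N → Bool) {x} → findF f ≡ just x → f x ≡ true
findF-sound {suc N} f e with f zero in f0
findF-sound {suc N} f refl | true = f0
... | false with findF (λ x → f (suc x)) in found
findF-sound {suc N} f refl | false | just y = findF-sound (λ x → f (suc x)) found

findF-complete : ∀ {N} (f : Fin N → Bool) x → f x ≡ true → ∃ λ y → findF f ≡ just y
findF-complete {suc N} f x e with f zero in f0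
... | true = zero , refl
... | false with findF (λ x → f (suc x)) in found
...   | just y = suc y , refl
findF-complete {suc N} f zero e | false | nothing = ⊥-elim (true≢false e f0)
findF-complete {suc N} f (suc x) e | false | nothing
  with y , found′ ← findF-complete (λ x → f (suc x)) x e
  with () ← trans (sym found) found′

if-==-here : ∀ {N} {X : Set} {x a : Fin N} {p q : X} → x ≡ a → (if x == a then p else q) ≡ p
if-==-here {a = a} refl rewrite ==-refl a = refl

if-==-there : ∀ {N} {X : Set} {x a : Fin N} {p q : X} → ¬ x ≡ a → (if x == a then p else q) ≡ q
if-==-there x≢a rewrite ≢⇒==-false x≢a = refl

if-exchange : ∀ {X : Set} b (x y : X) →
  ((if b then y else x) ≡ x × (if b then x else y) ≡ y) ⊎ ((if b then y else x) ≡ y × (if b then x else y) ≡ x)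
if-exchange true x y = inj₂ (refl , refl)
if-exchange false x y = inj₁ (refl , refl)

-- Vertices, half-edges and incidences

module Kinds {n k : ℕ} (P : Pair n k) where
  open Pair P

  Pr V H : Fin N → Set
  Pr x = present x ≡ true
  V x = isVᵇ P x ≡ true
  H x = isHᵇ P x ≡ true

  V-elim : ∀ {x} → V x → Pr x × r x ≡ x
  V-elim vx with pr , fixed ← ∧-elim vx = pr , ==⇒≡ fixed

  V-intro : ∀ {x} → Pr x → r x ≡ x → V x
  V-intro {x} pr fixed rewrite fixed = ∧-intro pr (==-refl x)

  H-elim : ∀ {x} → H x → Pr x × ¬ r x ≡ x
  H-elim hx with pr , moved ← ∧-elim hx = pr , ==-false⇒≢ (not≡true moved)

  H-intro : ∀ {x} → Pr x → ¬ r x ≡ x → H x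
  H-intro pr moved = ∧-intro pr (not≡false (≢⇒==-false moved))

  V⇒Pr : ∀ {x} → V x → Pr x
  V⇒Pr vx = proj₁ (V-elim vx)

  H⇒Pr : ∀ {x} → H x → Pr x
  H⇒Pr hx = proj₁ (H-elim hx)

  V⇒¬H : ∀ {x} → V x → ¬ H x
  V⇒¬H vx hx = proj₂ (H-elim hx) (proj₂ (V-elim vx))

  H⇒isV-false : ∀ {x} → H x → isVᵇ P x ≡ false
  H⇒isV-false hx = ¬true⇒false (λ vx → V⇒¬H vx hx)

  Pr⇒V⊎H : ∀ {x} → Pr x → V x ⊎ H x
  Pr⇒V⊎H {x} pr = classify (r x ≟ x)
    where
    classify : Dec (r x ≡ x) → V x ⊎ H x
    classify (yes fixed) = inj₁ (V-intro pr fixed)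
    classify (no moved) = inj₂ (H-intro pr moved)

  firstHalf : ℕ → Maybe (Fin N)
  firstHalf t = findF (λ x → isHᵇ P x ∧ (τ x ==ℕ t))

  firstHalf-sound : ∀ {t a} → firstHalf t ≡ just a → H a × τ a ≡ t
  firstHalf-sound found with ha , τa ← ∧-elim (findF-sound _ found) = ha , ==ℕ⇒≡ τa

  firstHalf-complete : ∀ {t x} → H x → τ x ≡ t → ∃ λ a → firstHalf t ≡ just a
  firstHalf-complete {x = x} hx refl = findF-complete _ x (∧-intro hx (==ℕ-refl _))

module Graph {g n k : ℕ} (G : Pair n k) (S : IsStablePair g G) where
  open Pair G
  open IsStablePair S
  open Kinds G public

  V-r : ∀ {x} → Pr x → V (r x)
  V-r pr = V-intro (T⇒≡true (r-closed _ (≡true⇒T pr))) (r-idem _ (≡true⇒T pr))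

  Pr-s : ∀ {x} → Pr x → Pr (s x)
  Pr-s pr = T⇒≡true (s-closed _ (≡true⇒T pr))

  s-s : ∀ {x} → Pr x → s (s x) ≡ x
  s-s pr = s-invol _ (≡true⇒T pr)

  V⇒s-fixed : ∀ {x} → V x → s x ≡ x
  V⇒s-fixed vx = fix-r⇒s _ (≡true⇒T (V⇒Pr vx)) (proj₂ (V-elim vx))

  H⇒s-moved : ∀ {x} → H x → ¬ s x ≡ x
  H⇒s-moved hx fixed = proj₂ (H-elim hx) (fix-s⇒r _ (≡true⇒T (H⇒Pr hx)) fixed)

  H-s : ∀ {x} → H x → H (s x)
  H-s {x} hx with Pr⇒V⊎H (Pr-s (H⇒Pr hx))
  ... | inj₂ hsx = hsx
  ... | inj₁ vsx = ⊥-elim (H⇒s-moved hx (trans (sym (V⇒s-fixed vsx)) (s-s (H⇒Pr hx))))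

  V-m : ∀ i → V (m i)
  V-m i = T⇒≡true (m-vertex i)

  τ-s : ∀ {x} → H x → τ (s x) ≡ τ x
  τ-s hx = τ-orbit _ (≡true⇒T hx)

  τ-injective : ∀ {a b} → H a → H b → τ a ≡ τ b → b ≡ a ⊎ b ≡ s a
  τ-injective ha hb = τ-inj _ _ (≡true⇒T ha) (≡true⇒T hb)

  τ<k : ∀ {x} → H x → τ x < k
  τ<k hx = τ-range _ (≡true⇒T hx)

  halfLabelled : (t : Fin k) → ∃ λ a → H a × τ a ≡ toℕ t
  halfLabelled t with a , ha , τa ← τ-surj (toℕ t) (toℕ<n t) = a , T⇒≡true ha , τa

  labelOf : ∀ {x} → H x → Fin k
  labelOf hx = fromℕ< (τ<k hx)

  τ≡labelOf : ∀ {x} (hx : H x) → τ x ≡ toℕ (labelOf hx)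
  τ≡labelOf hx = sym (toℕ-fromℕ< (τ<k hx))

  Inc : Fin k ⊎ Fin n → Fin N → Set
  Inc α y = incident G α y ≡ true

  EndOf : ℕ → Fin N → Set
  EndOf t y = ∃ λ x → H x × τ x ≡ t × r x ≡ y

  Inc₁-elim : ∀ t {y} → Inc (inj₁ t) y → EndOf (toℕ t) y
  Inc₁-elim t inc
    with x , found ← anyF-witness _ inc
    with hx , rest ← ∧-elim found
    with τx , rx ← ∧-elim rest
    = x , hx , ==ℕ⇒≡ τx , ==⇒≡ rx

  Inc₁-intro : ∀ t {y} → EndOf (toℕ t) y → Inc (inj₁ t) y
  Inc₁-intro t (x , hx , τx , refl) =
    anyF-intro _ x (∧-intro hx (∧-intro (subst (λ z → (z ==ℕ toℕ t) ≡ true) (sym τx) (==ℕ-refl _))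
                                        (==-refl (r x))))

  Inc₂-elim : ∀ {i y} → Inc (inj₂ i) y → m i ≡ y
  Inc₂-elim = ==⇒≡

  Inc₂-intro : ∀ {i y} → m i ≡ y → Inc (inj₂ i) y
  Inc₂-intro {i} refl = ==-refl (m i)

  Inc⇒V : ∀ α {y} → Inc α y → V y
  Inc⇒V (inj₁ t) inc with x , hx , _ , refl ← Inc₁-elim t inc = V-r (H⇒Pr hx)
  Inc⇒V (inj₂ i) inc rewrite sym (Inc₂-elim inc) = V-m i

  EndOf-cases : ∀ {a t y} → H a → τ a ≡ t → EndOf t y → y ≡ r a ⊎ y ≡ r (s a)
  EndOf-cases ha τa (x , hx , τx , refl) with τ-injective ha hx (trans τa (sym τx))
  ... | inj₁ refl = inj₁ refl
  ... | inj₂ refl = inj₂ refl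

  EndOf-r : ∀ {a t} → H a → τ a ≡ t → EndOf t (r a)
  EndOf-r ha τa = _ , ha , τa , refl

  EndOf-rs : ∀ {a t} → H a → τ a ≡ t → EndOf t (r (s a))
  EndOf-rs ha τa = _ , H-s ha , trans (τ-s ha) τa , refl

  shared : Fin k ⊎ Fin n → Fin k ⊎ Fin n → Fin N → Bool
  shared α β y = isVᵇ G y ∧ incident G α y ∧ incident G β y

  shared-elim : ∀ α β {y} → shared α β y ≡ true → Inc α y × Inc β y
  shared-elim α β {y} e with _ , both ← ∧-elim {isVᵇ G y} e = ∧-elim {incident G α y} both

  shared-intro : ∀ α β {y} → Inc α y → Inc β y → shared α β y ≡ true
  shared-intro α β incα incβ = ∧-intro (Inc⇒V α incα) (∧-intro incα incβ)

  private
    shared-diag-cases : ∀ {a t y} → H a → τ a ≡ toℕ t → shared (inj₁ t) (inj₁ t) y ≡ true →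
      y ≡ r a ⊎ y ≡ r (s a)
    shared-diag-cases {t = t} ha τa e =
      EndOf-cases ha τa (Inc₁-elim t (proj₁ (shared-elim (inj₁ t) (inj₁ t) e)))

    shared-diag : ∀ {a t y} → H a → τ a ≡ toℕ t → EndOf (toℕ t) y → shared (inj₁ t) (inj₁ t) y ≡ true
    shared-diag {t = t} ha τa end = shared-intro (inj₁ t) (inj₁ t) (Inc₁-intro t end) (Inc₁-intro t end)

  𝒬-loop : ∀ {a t} → H a → τ a ≡ toℕ t → r a ≡ r (s a) → 𝒬 G (inj₁ t) (inj₁ t) ≡ 1
  𝒬-loop {a} {t} ha τa loop =
    trans (countF-supported₁ _ (r a) at-r) (cong ind (shared-diag ha τa (EndOf-r ha τa)))
    where
    at-r : ∀ y → shared (inj₁ t) (inj₁ t) y ≡ true → y ≡ r a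
    at-r y e with shared-diag-cases ha τa e
    ... | inj₁ y≡ra = y≡ra
    ... | inj₂ y≡rsa = trans y≡rsa (sym loop)

  𝒬-nonloop : ∀ {a t} → H a → τ a ≡ toℕ t → ¬ r a ≡ r (s a) → 𝒬 G (inj₁ t) (inj₁ t) ≡ 2
  𝒬-nonloop {a} {t} ha τa nonloop =
    trans (countF-supported₂ _ (r a) (r (s a)) nonloop (λ y → shared-diag-cases ha τa))
      (cong₂ (λ p q → ind p + ind q) (shared-diag ha τa (EndOf-r ha τa)) (shared-diag ha τa (EndOf-rs ha τa)))

  firstHalf-orbit : ∀ {x a} → H x → firstHalf (τ x) ≡ just a → x ≡ a ⊎ x ≡ s a
  firstHalf-orbit hx found with ha , τa ← firstHalf-sound found = τ-injective ha hx τa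

  OnlyLoops : Set
  OnlyLoops = ∀ {x} → H x → r x ≡ r (s x)

  NonLoop-labelOf : ∀ {x} (hx : H x) → ¬ r x ≡ r (s x) → NonLoop G (toℕ (labelOf hx))
  NonLoop-labelOf hx nonloop = _ , ≡true⇒T hx , τ≡labelOf hx , nonloop

  OnlyLoops⊎NonLoop : OnlyLoops ⊎ (∃ λ j → NonLoop G (toℕ j))
  OnlyLoops⊎NonLoop with anyF (λ x → isHᵇ G x ∧ not (r x == r (s x))) in found
  ... | true with x , hit ← anyF-witness _ found with hx , nonloop ← ∧-elim {isHᵇ G x} hit =
    inj₂ (labelOf hx , NonLoop-labelOf hx (==-false⇒≢ (not≡true nonloop)))
  ... | false = inj₁ loop
    where
    loop : OnlyLoops
    loop {x} hx with r x ≟ r (s x)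
    ... | yes l = l
    ... | no nonloop = ⊥-elim (true≢false
      (anyF-intro (λ x → isHᵇ G x ∧ not (r x == r (s x))) x
                  (∧-intro hx (not≡false (≢⇒==-false nonloop)))) found)

-- Isomorphisms from vertex correspondences

record VertexCorrespondence {n k : ℕ} (G G' : Pair n k) : Set where
  private
    module A = Kinds G
    module B = Kinds G'
  field
    β    : Fin (Pair.N G) → Fin (Pair.N G')
    β⁻   : Fin (Pair.N G') → Fin (Pair.N G)
    β-V  : ∀ {x} → A.V x → B.V (β x)
    β⁻-V : ∀ {y} → B.V y → A.V (β⁻ y)
    β⁻∘β : ∀ {x} → A.V x → β⁻ (β x) ≡ x
    β∘β⁻ : ∀ {y} → B.V y → β (β⁻ y) ≡ y
    β-incident : ∀ α {x} → A.V x → incident G' α (β x) ≡ incident G α x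

  β-injective : ∀ {x y} → A.V x → A.V y → β x ≡ β y → x ≡ y
  β-injective vx vy e = trans (sym (β⁻∘β vx)) (trans (cong β⁻ e) (β⁻∘β vy))

reverse : ∀ {n k} {G G' : Pair n k} → VertexCorrespondence G G' → VertexCorrespondence G' G
reverse {G' = G'} C = record
  { β = β⁻ ; β⁻ = β ; β-V = β⁻-V ; β⁻-V = β-V ; β⁻∘β = β∘β⁻ ; β∘β⁻ = β⁻∘β
  ; β-incident = λ α vy → trans (sym (β-incident α (β⁻-V vy))) (cong (incident G' α) (β∘β⁻ vy))
  }
  where open VertexCorrespondence C

-- A half-edge x of G goes to the half of the equally labelled edge of G' lying over β (r x).
-- For a loop both halves qualify; then the first half (findF) of the label is sent to the half
-- lying over β (r a) and the other half to its partner.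
module HalfEdgeMap {n k : ℕ} (G G' : Pair n k) (β : Fin (Pair.N G) → Fin (Pair.N G')) where

  open Pair G using (N; r; s; τ)
  open Pair G' using () renaming (N to N'; r to r'; s to s'; τ to τ')

  align : Fin N → Fin N' → Fin N'
  align a a' = if r' a' == β (r a) then a' else s' a'

  halfMap : Fin N → Maybe (Fin N) → Maybe (Fin N') → Fin N'
  halfMap x (just a) (just a') = if x == a then align a a' else s' (align a a')
  halfMap x _ _ = β x

  φ : Fin N → Fin N'
  φ x = if isVᵇ G x then β x else halfMap x (Kinds.firstHalf G (τ x)) (Kinds.firstHalf G' (τ x))

module HalfEdgeMapProperties {g n k : ℕ} {G G' : Pair n k} (S : IsStablePair g G) (S' : IsStablePair g G')
  (C : VertexCorrespondence G G')
  (𝒬-diag : ∀ t → 𝒬 G (inj₁ t) (inj₁ t) ≡ 𝒬 G' (inj₁ t) (inj₁ t)) where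

  open VertexCorrespondence C
  open HalfEdgeMap G G' β public
  private
    module A = Graph G S
    module B = Graph G' S'
  open Pair G using (N; r; s; τ)
  open Pair G' using () renaming (N to N'; r to r'; s to s'; τ to τ')

  ends-match : ∀ {x x'} → A.H x → B.H x' → τ' x' ≡ τ x →
    (β (r x) ≡ r' x' × β (r (s x)) ≡ r' (s' x')) ⊎ (β (r x) ≡ r' (s' x') × β (r (s x)) ≡ r' x')
  ends-match {x} {x'} hx hx' τ'≡τ =
    match (r x ≟ r (s x)) (image-end (A.EndOf-r hx τx)) (image-end (A.EndOf-rs hx τx))
    where
    t = A.labelOf hx
    τx = A.τ≡labelOf hx
    τ'x' = trans τ'≡τ τx
    image-end : ∀ {y} → A.EndOf (toℕ t) y → β y ≡ r' x' ⊎ β y ≡ r' (s' x')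
    image-end end = B.EndOf-cases hx' τ'x'
      (B.Inc₁-elim t (trans (β-incident (inj₁ t) (A.Inc⇒V (inj₁ t) inc)) inc))
      where inc = A.Inc₁-intro t end
    loop-preserved : r x ≡ r (s x) → r' x' ≡ r' (s' x')
    loop-preserved loop with r' x' ≟ r' (s' x')
    ... | yes loop' = loop'
    ... | no nonloop'
      with () ← trans (sym (A.𝒬-loop hx τx loop)) (trans (𝒬-diag t) (B.𝒬-nonloop hx' τ'x' nonloop'))
    ends-distinct : β (r x) ≡ β (r (s x)) → r x ≡ r (s x)
    ends-distinct = β-injective (A.V-r (A.H⇒Pr hx)) (A.V-r (A.H⇒Pr (A.H-s hx)))
    match : Dec (r x ≡ r (s x)) → _ → _ →
      (β (r x) ≡ r' x' × β (r (s x)) ≡ r' (s' x')) ⊎ (β (r x) ≡ r' (s' x') × β (r (s x)) ≡ r' x')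
    match (yes loop) (inj₁ a) _ = inj₁ (a , trans (cong β (sym loop)) (trans a (loop-preserved loop)))
    match (yes loop) (inj₂ a) _ = inj₁ (trans a (sym (loop-preserved loop)) , trans (cong β (sym loop)) a)
    match (no _) (inj₁ a) (inj₂ b) = inj₁ (a , b)
    match (no _) (inj₂ a) (inj₁ b) = inj₂ (a , b)
    match (no nonloop) (inj₁ a) (inj₁ b) = ⊥-elim (nonloop (ends-distinct (trans a (sym b))))
    match (no nonloop) (inj₂ a) (inj₂ b) = ⊥-elim (nonloop (ends-distinct (trans a (sym b))))

  record HalfImage (x : Fin N) (y : Fin N') : Set where
    field
      half   : B.H y
      label  : τ' y ≡ τ x
      source : r' y ≡ β (r x)
      target : r' (s' y) ≡ β (r (s x))

  HalfImage-s : ∀ {x y} → A.H x → HalfImage x y → HalfImage (s x) (s' y)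
  HalfImage-s {x} {y} hx im = record
    { half = B.H-s half
    ; label = trans (B.τ-s half) (trans label (sym (A.τ-s hx)))
    ; source = target
    ; target = trans (cong r' (B.s-s (B.H⇒Pr half))) (trans source (cong (λ z → β (r z)) (sym (A.s-s (A.H⇒Pr hx)))))
    }
    where open HalfImage im

  align-at : ∀ {a a'} → r' a' ≡ β (r a) → align a a' ≡ a'
  align-at {a} at rewrite at | ==-refl (β (r a)) = refl

  align-off : ∀ {a a'} → ¬ r' a' ≡ β (r a) → align a a' ≡ s' a'
  align-off off rewrite ≢⇒==-false off = refl

  align-image : ∀ {a a'} → A.H a → B.H a' → τ' a' ≡ τ a → HalfImage a (align a a')
  align-image {a} {a'} ha ha' τ'≡τ = pick (r' a' ≟ β (r a)) (ends-match ha ha' τ'≡τ)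
    where
    pick : Dec (r' a' ≡ β (r a)) → _ → HalfImage a (align a a')
    pick (yes at) (inj₁ (_ , q)) = subst (HalfImage a) (sym (align-at at))
      (record { half = ha' ; label = τ'≡τ ; source = at ; target = sym q })
    pick (yes at) (inj₂ (p , q)) = subst (HalfImage a) (sym (align-at at))
      (record { half = ha' ; label = τ'≡τ ; source = at ; target = trans (sym (trans at p)) (sym q) })
    pick (no off) (inj₁ (p , _)) = ⊥-elim (off (sym p))
    pick (no off) (inj₂ (p , q)) = subst (HalfImage a) (sym (align-off off)) (record
      { half = B.H-s ha' ; label = trans (B.τ-s ha') τ'≡τ ; source = sym p
      ; target = trans (cong r' (B.s-s (B.H⇒Pr ha'))) (sym q) })

  φ-V : ∀ {x} → A.V x → φ x ≡ β x
  φ-V vx rewrite vx = refl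

  private
    φ-H : ∀ {x} → A.H x → ∀ {a a'} → A.firstHalf (τ x) ≡ just a → B.firstHalf (τ x) ≡ just a' →
      φ x ≡ halfMap x (just a) (just a')
    φ-H hx first first' rewrite A.H⇒isV-false hx | first | first' = refl

  φ-first : ∀ {a a'} → A.H a → A.firstHalf (τ a) ≡ just a → B.firstHalf (τ a) ≡ just a' →
    φ a ≡ align a a'
  φ-first {a} ha first first' rewrite φ-H ha first first' | ==-refl a = refl

  φ-partner : ∀ {a a'} → A.H a → A.firstHalf (τ a) ≡ just a → B.firstHalf (τ a) ≡ just a' →
    φ (s a) ≡ s' (align a a')
  φ-partner {a} ha first first'
    rewrite φ-H (A.H-s ha) (trans (cong A.firstHalf (A.τ-s ha)) first) (trans (cong B.firstHalf (A.τ-s ha)) first')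
          | ≢⇒==-false (A.H⇒s-moved ha) = refl

  φ-image-first : ∀ {a a'} → A.H a → A.firstHalf (τ a) ≡ just a → B.firstHalf (τ a) ≡ just a' →
    HalfImage a (φ a) × φ (s a) ≡ s' (φ a)
  φ-image-first {a} {a'} ha first first' =
    subst (HalfImage a) (sym φa)
      (align-image ha (proj₁ (B.firstHalf-sound first')) (proj₂ (B.firstHalf-sound first'))) ,
    trans (φ-partner ha first first') (cong s' (sym φa))
    where
    φa : φ a ≡ align a a'
    φa = φ-first ha first first'

  φ-image-partner : ∀ {a a'} → A.H a → A.firstHalf (τ a) ≡ just a → B.firstHalf (τ a) ≡ just a' →
    HalfImage (s a) (φ (s a)) × φ (s (s a)) ≡ s' (φ (s a))
  φ-image-partner {a} ha first first' =
    subst (HalfImage (s a)) (sym φsa) (HalfImage-s ha image) , ss-commutes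
    where
    image = proj₁ (φ-image-first ha first first')
    φsa = proj₂ (φ-image-first ha first first')
    ss-commutes : φ (s (s a)) ≡ s' (φ (s a))
    ss-commutes = begin
      φ (s (s a))       ≡⟨ cong φ (A.s-s (A.H⇒Pr ha)) ⟩
      φ a               ≡⟨ sym (B.s-s (B.H⇒Pr (HalfImage.half image))) ⟩
      s' (s' (φ a))     ≡⟨ cong s' (sym φsa) ⟩
      s' (φ (s a))      ∎
      where open ≡-Reasoning

  φ-image : ∀ {x} → A.H x → HalfImage x (φ x) × φ (s x) ≡ s' (φ x)
  φ-image {x} hx
    with a , first ← A.firstHalf-complete hx refl
    with b , hb , τb ← B.halfLabelled (A.labelOf hx)
    with a' , first' ← B.firstHalf-complete hb (trans τb (sym (A.τ≡labelOf hx)))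
    with ha , τa ← A.firstHalf-sound first
    with A.firstHalf-orbit hx first
  ... | inj₁ refl = φ-image-first hx first first'
  ... | inj₂ refl = φ-image-partner ha (trans (cong A.firstHalf τa) first)
                                      (trans (cong B.firstHalf τa) first')

  φ-Pr : ∀ {x} → A.Pr x → B.Pr (φ x)
  φ-Pr pr with A.Pr⇒V⊎H pr
  ... | inj₂ hx = B.H⇒Pr (HalfImage.half (proj₁ (φ-image hx)))
  ... | inj₁ vx = subst B.Pr (sym (φ-V vx)) (B.V⇒Pr (β-V vx))

  φ-s : ∀ {x} → A.Pr x → φ (s x) ≡ s' (φ x)
  φ-s pr with A.Pr⇒V⊎H pr
  ... | inj₂ hx = proj₂ (φ-image hx)
  ... | inj₁ vx = begin
    φ (s _)     ≡⟨ cong φ (A.V⇒s-fixed vx) ⟩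
    φ _         ≡⟨ φ-V vx ⟩
    β _           ≡⟨ sym (B.V⇒s-fixed (β-V vx)) ⟩
    s' (β _)      ≡⟨ cong s' (sym (φ-V vx)) ⟩
    s' (φ _)    ∎
    where open ≡-Reasoning

  φ-r : ∀ {x} → A.Pr x → φ (r x) ≡ r' (φ x)
  φ-r pr with A.Pr⇒V⊎H pr
  ... | inj₂ hx = trans (φ-V (A.V-r (A.H⇒Pr hx))) (sym (HalfImage.source (proj₁ (φ-image hx))))
  ... | inj₁ vx = begin
    φ (r _)     ≡⟨ cong φ (proj₂ (A.V-elim vx)) ⟩
    φ _         ≡⟨ φ-V vx ⟩
    β _           ≡⟨ sym (proj₂ (B.V-elim (β-V vx))) ⟩
    r' (β _)      ≡⟨ cong r' (sym (φ-V vx)) ⟩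
    r' (φ _)    ∎
    where open ≡-Reasoning

  φ-m : ∀ i → φ (Pair.m G i) ≡ Pair.m G' i
  φ-m i = trans (φ-V (A.V-m i))
    (sym (B.Inc₂-elim (trans (β-incident (inj₂ i) (A.V-m i)) (A.Inc₂-intro refl))))

module HalfEdgeMapInverse {g n k : ℕ} {G G' : Pair n k} (S : IsStablePair g G) (S' : IsStablePair g G')
  (C : VertexCorrespondence G G')
  (𝒬-diag : ∀ t → 𝒬 G (inj₁ t) (inj₁ t) ≡ 𝒬 G' (inj₁ t) (inj₁ t)) where

  private
    module A = Graph G S
    module B = Graph G' S'
    module F = HalfEdgeMapProperties S S' C 𝒬-diag
    module R = HalfEdgeMapProperties S' S (reverse C) (λ t → sym (𝒬-diag t))
    open VertexCorrespondence C
    open Pair G using (N; r; s; τ)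
    open Pair G' using () renaming (N to N'; r to r'; s to s'; τ to τ')

  φ-inverse-first : ∀ {a a'} → A.H a → A.firstHalf (τ a) ≡ just a → B.firstHalf (τ a) ≡ just a' →
    R.φ (F.φ a) ≡ a
  φ-inverse-first {a} {a'} ha first first' = at-or-off (r' a' ≟ β (r a))
    where
    open ≡-Reasoning
    ha' = proj₁ (B.firstHalf-sound first')
    τa' = proj₂ (B.firstHalf-sound first')
    first-a' : A.firstHalf (τ' a') ≡ just a
    first-a' = trans (cong A.firstHalf τa') first
    first'-a' : B.firstHalf (τ' a') ≡ just a'
    first'-a' = trans (cong B.firstHalf τa') first'
    V-ra' = B.V-r (B.H⇒Pr ha')
    at-or-off : Dec (r' a' ≡ β (r a)) → R.φ (F.φ a) ≡ a
    at-or-off (yes at) = begin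
      R.φ (F.φ a)          ≡⟨ cong R.φ (trans (F.φ-first ha first first') (F.align-at at)) ⟩
      R.φ a'               ≡⟨ R.φ-first ha' first'-a' first-a' ⟩
      R.align a' a         ≡⟨ R.align-at (sym (trans (cong β⁻ at) (β⁻∘β (A.V-r (A.H⇒Pr ha))))) ⟩
      a                    ∎
    at-or-off (no off) = begin
      R.φ (F.φ a)          ≡⟨ cong R.φ (trans (F.φ-first ha first first') (F.align-off off)) ⟩
      R.φ (s' a')          ≡⟨ R.φ-partner ha' first'-a' first-a' ⟩
      s (R.align a' a)     ≡⟨ cong s (R.align-off (λ e → off (trans (sym (β∘β⁻ V-ra')) (cong β (sym e))))) ⟩
      s (s a)              ≡⟨ A.s-s (A.H⇒Pr ha) ⟩
      a                    ∎

  φ-inverse-H : ∀ {x} → A.H x → R.φ (F.φ x) ≡ x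
  φ-inverse-H {x} hx
    with a , first ← A.firstHalf-complete hx refl
    with b , hb , τb ← B.halfLabelled (A.labelOf hx)
    with a' , first' ← B.firstHalf-complete hb (trans τb (sym (A.τ≡labelOf hx)))
    with ha , τa ← A.firstHalf-sound first
    with A.firstHalf-orbit hx first
  ... | inj₁ refl = φ-inverse-first hx first first'
  ... | inj₂ refl = begin
    R.φ (F.φ (s a))      ≡⟨ cong R.φ (proj₂ (F.φ-image ha)) ⟩
    R.φ (s' (F.φ a))     ≡⟨ proj₂ (R.φ-image (F.HalfImage.half (proj₁ (F.φ-image ha)))) ⟩
    s (R.φ (F.φ a))      ≡⟨ cong s (φ-inverse-first ha (trans (cong A.firstHalf τa) first)
                                                           (trans (cong B.firstHalf τa) first')) ⟩
    s a                  ∎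
    where open ≡-Reasoning

  φ-inverse : ∀ {x} → A.Pr x → R.φ (F.φ x) ≡ x
  φ-inverse pr with A.Pr⇒V⊎H pr
  ... | inj₂ hx = φ-inverse-H hx
  ... | inj₁ vx = trans (cong R.φ (F.φ-V vx)) (trans (R.φ-V (β-V vx)) (β⁻∘β vx))

b1≡genus⇒totalWeight≡0 : ∀ {g n k} {G : Pair n k} → IsStablePair g G → b1 G ≡ + g → totalWeight G ≡ 0
b1≡genus⇒totalWeight≡0 {G = G} S b1≡g = ℤₚ.+-injective (∙-cancelˡ (b1 G) _ _ (begin
    b1 G ℤ.+ + totalWeight G  ≡⟨ IsStablePair.genus S ⟩
    + _                       ≡⟨ sym b1≡g ⟩
    b1 G                      ≡⟨ sym (ℤₚ.+-identityʳ (b1 G)) ⟩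
    b1 G ℤ.+ + 0              ∎))
  where open ≡-Reasoning

totalWeight≡0⇒w≡0 : ∀ {n k} (G : Pair n k) → totalWeight G ≡ 0 →
  ∀ {x} → isVᵇ G x ≡ true → Pair.w G x ≡ 0
totalWeight≡0⇒w≡0 G tw≡0 {x} vx =
  subst (λ b → (if b then Pair.w G x else 0) ≡ 0) vx (sumF≡0⇒≡0 _ tw≡0 x)

module _ {g n k : ℕ} {G G' : Pair n k} (S : IsStablePair g G) (S' : IsStablePair g G')
  (C : VertexCorrespondence G G')
  (𝒬-diag : ∀ t → 𝒬 G (inj₁ t) (inj₁ t) ≡ 𝒬 G' (inj₁ t) (inj₁ t)) where

  private
    module A = Graph G S
    module B = Graph G' S'
    module F = HalfEdgeMapProperties S S' C 𝒬-diag
    module R = HalfEdgeMapProperties S' S (reverse C) (λ t → sym (𝒬-diag t))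
    open VertexCorrespondence C

    φ-inverseˡ : ∀ {x} → A.Pr x → R.φ (F.φ x) ≡ x
    φ-inverseˡ = HalfEdgeMapInverse.φ-inverse S S' C 𝒬-diag

    φ-inverseʳ : ∀ {y} → B.Pr y → F.φ (R.φ y) ≡ y
    φ-inverseʳ = HalfEdgeMapInverse.φ-inverse S' S (reverse C) (λ t → sym (𝒬-diag t))

    #V≡ : #V G ≡ #V G'
    #V≡ = countF-≡-bij _ _ β β⁻ (λ _ → β-V) (λ _ → β⁻-V) (λ _ → β⁻∘β) (λ _ → β∘β⁻)

    #H≡ : #H G ≡ #H G'
    #H≡ = countF-≡-bij _ _ F.φ R.φ
      (λ _ hx → F.HalfImage.half (proj₁ (F.φ-image hx))) (λ _ hy → R.HalfImage.half (proj₁ (R.φ-image hy)))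
      (λ _ hx → φ-inverseˡ (A.H⇒Pr hx)) (λ _ hy → φ-inverseʳ (B.H⇒Pr hy))

    b1≡ : b1 G ≡ b1 G'
    b1≡ rewrite #V≡ | #H≡ = refl

  ≅-from-correspondence : b1 G ≡ + g → G ≅ G'
  ≅-from-correspondence b1≡g = record
    { φ = F.φ
    ; ψ = R.φ
    ; φ-In = λ _ pr → ≡true⇒T (F.φ-Pr (T⇒≡true pr))
    ; ψ-In = λ _ pr → ≡true⇒T (R.φ-Pr (T⇒≡true pr))
    ; ψφ = λ _ pr → φ-inverseˡ (T⇒≡true pr)
    ; φψ = λ _ pr → φ-inverseʳ (T⇒≡true pr)
    ; φ-s = λ _ pr → F.φ-s (T⇒≡true pr)
    ; φ-r = λ _ pr → F.φ-r (T⇒≡true pr)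
    ; φ-w = λ _ vx → trans (cong (Pair.w G') (F.φ-V (T⇒≡true vx)))
              (trans (totalWeight≡0⇒w≡0 G' totalWeight'≡0 (β-V (T⇒≡true vx)))
                     (sym (totalWeight≡0⇒w≡0 G (b1≡genus⇒totalWeight≡0 S b1≡g) (T⇒≡true vx))))
    ; φ-m = F.φ-m
    ; φ-τ = λ _ hx → F.HalfImage.label (proj₁ (F.φ-image (T⇒≡true hx)))
    }
    where
    totalWeight'≡0 = b1≡genus⇒totalWeight≡0 S' (trans (sym b1≡) b1≡g)

-- Contraction of a non-loop edge

unrelabel : ℕ → ℕ → ℕ
unrelabel j t = if t <ᵇ j then t else suc t

unrelabel-relabel : ∀ j t → ¬ t ≡ j → unrelabel j (relabel j t) ≡ t
unrelabel-relabel j t t≢j with t <ᵇ j in t<j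
... | true rewrite t<j = refl
unrelabel-relabel zero zero t≢j | false = ⊥-elim (t≢j refl)
unrelabel-relabel (suc j) zero t≢j | false with () ← t<j
unrelabel-relabel j (suc t) t≢j | false with t <ᵇ j in t<j'
... | false = refl
... | true = ⊥-elim (t≢j (ℕₚ.≤-antisym (ℕₚ.<ᵇ⇒< t j (≡true⇒T t<j'))
                                       (ℕₚ.≮⇒≥ (λ 1+t<j → true≢false (T⇒≡true (ℕₚ.<⇒<ᵇ 1+t<j)) t<j))))

relabel-injective : ∀ j {t t'} → ¬ t ≡ j → ¬ t' ≡ j → relabel j t ≡ relabel j t' → t ≡ t'
relabel-injective j {t} {t'} t≢j t'≢j e = begin
  t                              ≡⟨ sym (unrelabel-relabel j t t≢j) ⟩
  unrelabel j (relabel j t)      ≡⟨ cong (unrelabel j) e ⟩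
  unrelabel j (relabel j t')     ≡⟨ unrelabel-relabel j t' t'≢j ⟩
  t'                             ∎
  where open ≡-Reasoning

record Embedding {n k : ℕ} (P P' : Pair n k) : Set where
  private
    module A = Pair P
    module B = Pair P'
    module KA = Kinds P
    module KB = Kinds P'
  field
    f           : Fin A.N → Fin B.N
    f-Pr        : ∀ {x} → KA.Pr x → KB.Pr (f x)
    f-injective : ∀ {x y} → KA.Pr x → KA.Pr y → f x ≡ f y → x ≡ y
    f-r         : ∀ {x} → KA.Pr x → f (A.r x) ≡ B.r (f x)
    f-τ         : ∀ {x} → KA.H x → B.τ (f x) ≡ A.τ x
    f-m         : ∀ i → f (A.m i) ≡ B.m i

  f-V : ∀ {x} → KA.V x → KB.V (f x)
  f-V vx with px , fixed ← KA.V-elim vx = KB.V-intro (f-Pr px) (trans (sym (f-r px)) (cong f fixed))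

module _ {n k : ℕ} {P P' : Pair n k} (ι : P ≅ P') where
  open _≅_ ι
  private
    module A = Pair P
    module B = Pair P'
    module KA = Kinds P
    module KB = Kinds P'

  ≅⇒Embedding : Embedding P P'
  ≅⇒Embedding = record
    { f = φ
    ; f-Pr = λ px → T⇒≡true (φ-In _ (≡true⇒T px))
    ; f-injective = λ px py e → trans (sym (ψφ _ (≡true⇒T px))) (trans (cong ψ e) (ψφ _ (≡true⇒T py)))
    ; f-r = λ px → φ-r _ (≡true⇒T px)
    ; f-τ = λ hx → φ-τ _ (≡true⇒T hx)
    ; f-m = φ-m
    }

  ≅⇒Embedding⁻ : (∀ {x} → KA.Pr x → KA.Pr (A.r x)) → (∀ i → KA.Pr (A.m i)) → Embedding P' P
  ≅⇒Embedding⁻ r-closed m-Pr = record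
    { f = ψ
    ; f-Pr = ψ-Pr
    ; f-injective = λ py py' e → trans (sym (φψ′ py)) (trans (cong φ e) (φψ′ py'))
    ; f-r = λ {y} py → begin
        ψ (B.r y)             ≡⟨ cong (λ z → ψ (B.r z)) (sym (φψ′ py)) ⟩
        ψ (B.r (φ (ψ y)))     ≡⟨ cong ψ (sym (φ-r _ (≡true⇒T (ψ-Pr py)))) ⟩
        ψ (φ (A.r (ψ y)))     ≡⟨ ψφ′ (r-closed (ψ-Pr py)) ⟩
        A.r (ψ y)             ∎
    ; f-τ = ψ-τ
    ; f-m = λ i → trans (cong ψ (sym (φ-m i))) (ψφ′ (m-Pr i))
    }
    where
    open ≡-Reasoning
    ψ-Pr : ∀ {y} → KB.Pr y → KA.Pr (ψ y)
    ψ-Pr py = T⇒≡true (ψ-In _ (≡true⇒T py))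
    ψφ′ : ∀ {x} → KA.Pr x → ψ (φ x) ≡ x
    ψφ′ px = ψφ _ (≡true⇒T px)
    φψ′ : ∀ {y} → KB.Pr y → φ (ψ y) ≡ y
    φψ′ py = φψ _ (≡true⇒T py)
    ψ-τ : ∀ {y} → KB.H y → A.τ (ψ y) ≡ B.τ y
    ψ-τ {y} hy with KA.Pr⇒V⊎H (ψ-Pr (KB.H⇒Pr hy))
    ... | inj₂ hψy = trans (sym (φ-τ _ (≡true⇒T hψy))) (cong B.τ (φψ′ (KB.H⇒Pr hy)))
    ... | inj₁ vψy = ⊥-elim (KB.V⇒¬H (subst KB.V (φψ′ (KB.H⇒Pr hy)) (Embedding.f-V ≅⇒Embedding vψy)) hy)

contractAt : ∀ {n p} → (G : Pair n (suc p)) → Fin (suc p) → Fin (Pair.N G) → Pair n p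
contractAt G j h = record
  { N       = N
  ; present = λ x → present x ∧ not ((x == h) ∨ (x == s h) ∨ (x == v))
  ; s       = s
  ; r       = λ x → merge (r x)
  ; w       = λ x → if x == u then w u + w v else w x
  ; m       = λ i → merge (m i)
  ; τ       = λ x → relabel (toℕ j) (τ x)
  }
  where
  open Pair G
  u v : Fin N
  u = r h
  v = r (s h)
  merge : Fin N → Fin N
  merge y = if y == v then u else y

contract-just : ∀ {n p} (G : Pair n (suc p)) (j : Fin (suc p)) {h : Fin (Pair.N G)} →
  findF (λ x → isHᵇ G x ∧ (Pair.τ G x ==ℕ toℕ j)) ≡ just h → contract G j ≡ contractAt G j h
contract-just G j found with findF (λ x → isHᵇ G x ∧ (Pair.τ G x ==ℕ toℕ j))
contract-just G j refl | just _ = refl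

record NonLoopHalf {g n p : ℕ} (G : Pair n (suc p)) (S : IsStablePair g G) (j : Fin (suc p)) : Set where
  field
    h         : Fin (Pair.N G)
    h-first   : Graph.firstHalf G S (toℕ j) ≡ just h
    h-nonloop : ¬ Pair.r G h ≡ Pair.r G (Pair.s G h)

NonLoop⇒NonLoopHalf : ∀ {g n p} {G : Pair n (suc p)} (S : IsStablePair g G) {j : Fin (suc p)} →
  NonLoop G (toℕ j) → NonLoopHalf G S j
NonLoop⇒NonLoopHalf {G = G} S (x , hx , τx , nonloop)
  with h , first ← Graph.firstHalf-complete G S (T⇒≡true hx) τx
  with Graph.firstHalf-orbit G S (T⇒≡true hx) (trans (cong (Graph.firstHalf G S) τx) first)
... | inj₁ refl = record { h = h ; h-first = first ; h-nonloop = nonloop }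
... | inj₂ refl = record
  { h = h ; h-first = first ; h-nonloop = λ loop → nonloop (trans (sym loop) (cong r (sym (s-s (H⇒Pr ha))))) }
  where
  open Pair G
  open Graph G S using (s-s; H⇒Pr)
  ha = proj₁ (Graph.firstHalf-sound G S first)

module Contraction {g n p : ℕ} {G : Pair n (suc p)} {S : IsStablePair g G} {j : Fin (suc p)}
  (X : NonLoopHalf G S j) where

  open NonLoopHalf X
  open Graph G S public
  open Pair G public

  C : Pair n p
  C = contractAt G j h
  open Kinds C public using () renaming (Pr to PrC; V to VC; H to HC)
  private
    module K = Kinds C

  H-h : H h
  H-h = proj₁ (firstHalf-sound h-first)

  τ-h : τ h ≡ toℕ j
  τ-h = proj₂ (firstHalf-sound h-first)

  contract≡ : contract G j ≡ C
  contract≡ = contract-just G j h-first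

  u v : Fin N
  u = r h
  v = r (s h)

  merge : Fin N → Fin N
  merge y = if y == v then u else y

  u≢v : ¬ u ≡ v
  u≢v = h-nonloop

  V-u : V u
  V-u = V-r (H⇒Pr H-h)

  V-v : V v
  V-v = V-r (H⇒Pr (H-s H-h))

  merge-v : merge v ≡ u
  merge-v rewrite ==-refl v = refl

  merge-other : ∀ {y} → ¬ y ≡ v → merge y ≡ y
  merge-other y≢v rewrite ≢⇒==-false y≢v = refl

  merge-u : merge u ≡ u
  merge-u = merge-other u≢v

  merge-V : ∀ {y} → V y → V (merge y) × ¬ merge y ≡ v
  merge-V {y} vy with y == v in y=v
  ... | true = V-u , u≢v
  ... | false = vy , ==-false⇒≢ y=v

  merge≡u : ∀ {y} → merge y ≡ u → y ≡ u ⊎ y ≡ v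
  merge≡u {y} e with y == v in y=v
  ... | true = inj₂ (==⇒≡ y=v)
  ... | false = inj₁ e

  merge-away : ∀ {y z} → ¬ z ≡ u → ¬ z ≡ v → merge y ≡ z → y ≡ z
  merge-away {y} z≢u z≢v e with y == v
  ... | true = ⊥-elim (z≢u (sym e))
  ... | false = e

  labelled-j : ∀ {x} → H x → τ x ≡ toℕ j → x ≡ h ⊎ x ≡ s h
  labelled-j hx τx = τ-injective H-h hx (trans τ-h (sym τx))

  V≢H : ∀ {x y} → V x → H y → ¬ x ≡ y
  V≢H vx hy refl = V⇒¬H vx hy

  PrC-elim : ∀ {x} → PrC x → Pr x × ¬ x ≡ h × ¬ x ≡ s h × ¬ x ≡ v
  PrC-elim e
    with pr , kept ← ∧-elim e
    with x≠h , rest ← ∨-false-elim (not≡true kept)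
    with x≠sh , x≠v ← ∨-false-elim rest
    = pr , ==-false⇒≢ x≠h , ==-false⇒≢ x≠sh , ==-false⇒≢ x≠v

  PrC-intro : ∀ {x} → Pr x → ¬ x ≡ h → ¬ x ≡ s h → ¬ x ≡ v → PrC x
  PrC-intro pr x≢h x≢sh x≢v
    rewrite ≢⇒==-false x≢h | ≢⇒==-false x≢sh | ≢⇒==-false x≢v = ∧-intro pr refl

  PrC-cases : ∀ {x} → PrC x → (V x × ¬ x ≡ v) ⊎ (H x × ¬ τ x ≡ toℕ j)
  PrC-cases e with pr , x≢h , x≢sh , x≢v ← PrC-elim e with Pr⇒V⊎H pr
  ... | inj₁ vx = inj₁ (vx , x≢v)
  ... | inj₂ hx = inj₂ (hx , λ τx → [ x≢h , x≢sh ] (labelled-j hx τx))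

  VC-intro : ∀ {y} → V y → ¬ y ≡ v → VC y
  VC-intro {y} vy y≢v = K.V-intro
    (PrC-intro (V⇒Pr vy) (λ e → V≢H vy H-h e) (λ e → V≢H vy (H-s H-h) e) y≢v)
    (trans (cong merge (proj₂ (V-elim vy))) (merge-other y≢v))

  VC-r : ∀ {x} → PrC x → VC (Pair.r C x)
  VC-r e with vmx , mx≢v ← merge-V (V-r (proj₁ (PrC-elim e))) = VC-intro vmx mx≢v

  VC-elim : ∀ {x} → VC x → V x × ¬ x ≡ v
  VC-elim {x} e with pr , fixed ← K.V-elim e with PrC-cases pr
  ... | inj₁ vertex = vertex
  ... | inj₂ (hx , _) = ⊥-elim (V≢H (proj₁ (merge-V (V-r (H⇒Pr hx)))) hx fixed)

  HC-intro : ∀ {x} → H x → ¬ τ x ≡ toℕ j → HC x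
  HC-intro {x} hx τx≢j = K.H-intro
    (PrC-intro (H⇒Pr hx) (λ { refl → τx≢j τ-h }) (λ { refl → τx≢j (trans (τ-s H-h) τ-h) })
               (λ e → V≢H V-v hx (sym e)))
    (λ e → V≢H (proj₁ (merge-V (V-r (H⇒Pr hx)))) hx e)

  HC-elim : ∀ {x} → HC x → H x × ¬ τ x ≡ toℕ j
  HC-elim {x} e with pr , moved ← K.H-elim e with PrC-cases pr
  ... | inj₂ half = half
  ... | inj₁ (vx , x≢v) =
    ⊥-elim (moved (trans (cong merge (proj₂ (V-elim vx))) (merge-other x≢v)))

  PrC-m : ∀ i → PrC (Pair.m C i)
  PrC-m i = K.V⇒Pr (VC-intro (proj₁ (merge-V (V-m i))) (proj₂ (merge-V (V-m i))))

  -- Incidence in the contraction, with edges still named by their labels in G.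
  IncC : Fin (suc p) ⊎ Fin n → Fin N → Set
  IncC (inj₁ t) z = ∃ λ x → H x × τ x ≡ toℕ t × merge (r x) ≡ z
  IncC (inj₂ i) z = merge (m i) ≡ z

  Inc⇔IncC-away : ∀ α {y} → ¬ y ≡ u → ¬ y ≡ v → Inc α y ⇔ IncC α y
  Inc⇔IncC-away (inj₁ t) y≢u y≢v = mk⇔
    (λ inc → let (x , hx , τx , rx) = Inc₁-elim t inc in x , hx , τx , trans (cong merge rx) (merge-other y≢v))
    (λ (x , hx , τx , e) → Inc₁-intro t (x , hx , τx , merge-away y≢u y≢v e))
  Inc⇔IncC-away (inj₂ i) y≢u y≢v = mk⇔
    (λ inc → trans (cong merge (Inc₂-elim inc)) (merge-other y≢v))
    (λ e → Inc₂-intro (merge-away y≢u y≢v e))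

  Inc⇔IncC-merged : ∀ α → (Inc α u ⊎ Inc α v) ⇔ IncC α u
  Inc⇔IncC-merged (inj₁ t) = mk⇔ to from
    where
    to : Inc (inj₁ t) u ⊎ Inc (inj₁ t) v → IncC (inj₁ t) u
    to (inj₁ inc) with x , hx , τx , rx ← Inc₁-elim t inc = x , hx , τx , trans (cong merge rx) merge-u
    to (inj₂ inc) with x , hx , τx , rx ← Inc₁-elim t inc = x , hx , τx , trans (cong merge rx) merge-v
    from : IncC (inj₁ t) u → Inc (inj₁ t) u ⊎ Inc (inj₁ t) v
    from (x , hx , τx , e) with merge≡u e
    ... | inj₁ rx≡u = inj₁ (Inc₁-intro t (x , hx , τx , rx≡u))
    ... | inj₂ rx≡v = inj₂ (Inc₁-intro t (x , hx , τx , rx≡v))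
  Inc⇔IncC-merged (inj₂ i) = mk⇔ to from
    where
    to : Inc (inj₂ i) u ⊎ Inc (inj₂ i) v → IncC (inj₂ i) u
    to (inj₁ inc) rewrite Inc₂-elim inc = merge-u
    to (inj₂ inc) rewrite Inc₂-elim inc = merge-v
    from : IncC (inj₂ i) u → Inc (inj₂ i) u ⊎ Inc (inj₂ i) v
    from e with merge≡u e
    ... | inj₁ mi≡u = inj₁ (Inc₂-intro mi≡u)
    ... | inj₂ mi≡v = inj₂ (Inc₂-intro mi≡v)

  e : Fin (suc p) ⊎ Fin n
  e = inj₁ j

  Inc-e : ∀ {y} → Inc e y → y ≡ u ⊎ y ≡ v
  Inc-e inc = EndOf-cases H-h τ-h (Inc₁-elim j inc)

  𝒬-row-e : ∀ α → 𝒬 G e α ≡ ind (incident G α u) + ind (incident G α v)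
  𝒬-row-e α = trans (countF-supported₂ _ u v u≢v (λ y sh → Inc-e (proj₁ (shared-elim e α sh))))
    (cong₂ (λ a b → ind a + ind b) (at-end V-u (EndOf-r H-h τ-h)) (at-end V-v (EndOf-rs H-h τ-h)))
    where
    at-end : ∀ {y} → V y → EndOf (toℕ j) y → shared e α y ≡ incident G α y
    at-end {y} vy end rewrite vy | Inc₁-intro j end = refl

  Off : Fin N → Set
  Off y = V y × ¬ y ≡ u × ¬ y ≡ v

  V-cases : ∀ {y} → V y → y ≡ u ⊎ y ≡ v ⊎ Off y
  V-cases {y} vy with y ≟ u | y ≟ v
  ... | yes y≡u | _ = inj₁ y≡u
  ... | no _ | yes y≡v = inj₂ (inj₁ y≡v)
  ... | no y≢u | no y≢v = inj₂ (inj₂ (vy , y≢u , y≢v))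

  sharedOff : Fin (suc p) ⊎ Fin n → Fin (suc p) ⊎ Fin n → Fin N → Bool
  sharedOff α γ y = (shared α γ y ∧ not (y == u)) ∧ not (y == v)

  sharedOff-elim : ∀ α γ {y} → sharedOff α γ y ≡ true → Off y × Inc α y × Inc γ y
  sharedOff-elim α γ {y} sh-off
    with sh-u , y≠v ← ∧-elim {shared α γ y ∧ not (y == u)} sh-off
    with sh , y≠u ← ∧-elim {shared α γ y} sh-u
    with incα , incγ ← shared-elim α γ sh
    = (Inc⇒V α incα , ==-false⇒≢ (not≡true y≠u) , ==-false⇒≢ (not≡true y≠v)) , incα , incγ

  sharedOff-intro : ∀ α γ {y} → Off y → Inc α y → Inc γ y → sharedOff α γ y ≡ true
  sharedOff-intro α γ (_ , y≢u , y≢v) incα incγ =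
    ∧-intro (∧-intro (shared-intro α γ incα incγ) (not≡false (≢⇒==-false y≢u)))
            (not≡false (≢⇒==-false y≢v))

  𝒬-split : ∀ α γ → 𝒬 G α γ ≡
    ind (incident G α u ∧ incident G γ u) + (ind (incident G α v ∧ incident G γ v) + countF (sharedOff α γ))
  𝒬-split α γ rewrite countF-split₂ (shared α γ) u v u≢v | V-u | V-v = refl

module ContractionMap {g n p : ℕ} {G G' : Pair n (suc p)} {S : IsStablePair g G} {S' : IsStablePair g G'}
  {j : Fin (suc p)} (X : NonLoopHalf G S j) (X' : NonLoopHalf G' S' j)
  (E : Embedding (Contraction.C X) (Contraction.C X')) where

  private
    module A = Contraction X
    module B = Contraction X'
    module KA = Kinds A.C
    module KB = Kinds B.C
  open Embedding E

  f-HC : ∀ {x} → A.HC x → B.HC (f x)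
  f-HC hx with px , moved ← KA.H-elim hx =
    KB.H-intro (f-Pr px) (λ fixed → moved (f-injective (KA.V⇒Pr (A.VC-r px)) px (trans (f-r px) fixed)))

  f-τ-uncontracted : ∀ {x} → A.HC x → B.τ (f x) ≡ A.τ x
  f-τ-uncontracted hx =
    relabel-injective (toℕ j) (proj₂ (B.HC-elim (f-HC hx))) (proj₂ (A.HC-elim hx)) (f-τ hx)

  f-IncC : ∀ α → ¬ α ≡ A.e → ∀ {z} → A.VC z → A.IncC α z → B.IncC α (f z)
  f-IncC (inj₁ t) α≢e {z} _ (x , hx , τx , rx) =
    f x , proj₁ (B.HC-elim (f-HC hxC)) , trans (f-τ-uncontracted hxC) τx ,
    trans (sym (f-r (KA.H⇒Pr hxC))) (cong f rx)
    where
    hxC = A.HC-intro hx (λ τx≡j → α≢e (cong inj₁ (toℕ-injective (trans (sym τx) τx≡j))))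
  f-IncC (inj₂ i) _ _ mi = trans (sym (f-m i)) (cong f mi)

-- Exchanging the two endpoints

ind+ind-injective : ∀ a b c d → ind a + ind b ≡ ind c + ind d → (a ∨ b) ≡ (c ∨ d) × (a ∧ b) ≡ (c ∧ d)
ind+ind-injective false false false false _ = refl , refl
ind+ind-injective false true  false true  _ = refl , refl
ind+ind-injective false true  true  false _ = refl , refl
ind+ind-injective true  false false true  _ = refl , refl
ind+ind-injective true  false true  false _ = refl , refl
ind+ind-injective true  true  true  true  _ = refl , refl
ind+ind-injective false false false true  ()
ind+ind-injective false false true  false ()
ind+ind-injective false false true  true  ()
ind+ind-injective false true  false false ()
ind+ind-injective false true  true  true  ()
ind+ind-injective true  false false false ()
ind+ind-injective true  false true  true  ()
ind+ind-injective true  true  false false ()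
ind+ind-injective true  true  false true  ()
ind+ind-injective true  true  true  false ()

xor-true : ∀ {a b} → (a xor b) ≡ true → b ≡ not a
xor-true {false} {true} _ = refl
xor-true {true} {false} _ = refl

xor-false : ∀ {a b} → (a xor b) ≡ false → b ≡ a
xor-false {false} {false} _ = refl
xor-false {true} {true} _ = refl

∨∧-equal-pair : ∀ {a a' b'} → (a ∨ a) ≡ (a' ∨ b') → (a ∧ a) ≡ (a' ∧ b') → a' ≡ a × b' ≡ a
∨∧-equal-pair {false} {false} {false} _ _ = refl , refl
∨∧-equal-pair {true} {true} {true} _ _ = refl , refl
∨∧-equal-pair {false} {false} {true} () _
∨∧-equal-pair {false} {true} () _
∨∧-equal-pair {true} {true} {false} _ ()
∨∧-equal-pair {true} {false} {true} _ ()
∨∧-equal-pair {true} {false} {false} () _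

∨∧-split-pair : ∀ {a b a' b'} → (a xor b) ≡ true → (a ∨ b) ≡ (a' ∨ b') → (a ∧ b) ≡ (a' ∧ b') →
  b ≡ not a × b' ≡ not a'
∨∧-split-pair {false} {true} {false} {true} _ _ _ = refl , refl
∨∧-split-pair {false} {true} {true} {false} _ _ _ = refl , refl
∨∧-split-pair {true} {false} {false} {true} _ _ _ = refl , refl
∨∧-split-pair {true} {false} {true} {false} _ _ _ = refl , refl
∨∧-split-pair {false} {true} {false} {false} _ () _
∨∧-split-pair {false} {true} {true} {true} _ _ ()
∨∧-split-pair {true} {false} {false} {false} _ () _
∨∧-split-pair {true} {false} {true} {true} _ _ ()

-- The overlaps of (a, ¬a) with (c, ¬c), and of (a', ¬a') with the exchanged pair (¬c, c).
swap-forced : ∀ {a a'} c →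
  ind (a ∧ c) + ind (not a ∧ not c) ≡ ind (a' ∧ not c) + ind (not a' ∧ not (not c)) → a' ≡ not a
swap-forced {false} {true} c _ = refl
swap-forced {true} {false} c _ = refl
swap-forced {false} {false} false ()
swap-forced {false} {false} true ()
swap-forced {true} {true} false ()
swap-forced {true} {true} true ()

swap-propagates : ∀ {a b a' b' c d c' d'} →
  (a xor b) ≡ true → (a ∨ b) ≡ (a' ∨ b') → (a ∧ b) ≡ (a' ∧ b') →
  (c xor d) ≡ true → (c ∨ d) ≡ (c' ∨ d') → (c ∧ d) ≡ (c' ∧ d') → (c xor c') ≡ true →
  ind (a ∧ c) + ind (b ∧ d) ≡ ind (a' ∧ c') + ind (b' ∧ d') → a' ≡ b × b' ≡ a
swap-propagates {a} {b} {a'} {b'} {c} {d} {c'} {d'} sep-ab or-ab and-ab sep-cd or-cd and-cd c-flipped crossing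
  with refl , refl ← ∨∧-split-pair {a} {b} {a'} {b'} sep-ab or-ab and-ab
  with refl , refl ← ∨∧-split-pair {c} {d} {c'} {d'} sep-cd or-cd and-cd
  with refl ← xor-true {c} c-flipped
  with refl ← swap-forced {a} {a'} c crossing
  = refl , not-involutive a

module EndpointSwap {k n : ℕ} (a b a' b' : Fin k ⊎ Fin n → Bool)
  (overlaps : ∀ α γ → ind (a α ∧ a γ) + ind (b α ∧ b γ) ≡ ind (a' α ∧ a' γ) + ind (b' α ∧ b' γ))
  where

  same-pair : ∀ α → (a α ∨ b α) ≡ (a' α ∨ b' α) × (a α ∧ b α) ≡ (a' α ∧ b' α)
  same-pair α = ind+ind-injective (a α) (b α) (a' α) (b' α) (begin
    ind (a α) + ind (b α)
      ≡⟨ cong₂ (λ x y → ind x + ind y) (sym (∧-idem (a α))) (sym (∧-idem (b α))) ⟩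
    ind (a α ∧ a α) + ind (b α ∧ b α)
      ≡⟨ overlaps α α ⟩
    ind (a' α ∧ a' α) + ind (b' α ∧ b' α)
      ≡⟨ cong₂ (λ x y → ind x + ind y) (∧-idem (a' α)) (∧-idem (b' α)) ⟩
    ind (a' α) + ind (b' α) ∎)
    where open ≡-Reasoning

  separates mismatched : Fin k ⊎ Fin n → Bool
  separates α = a α xor b α
  mismatched α = separates α ∧ (a α xor a' α)

  swapped : Bool
  swapped = anyF (λ t → mismatched (inj₁ t)) ∨ anyF (λ i → mismatched (inj₂ i))

  swapped-witness : swapped ≡ true → ∃ λ γ → mismatched γ ≡ true
  swapped-witness sw with ∨-elim sw
  ... | inj₁ found with t , mt ← anyF-witness _ found = inj₁ t , mt
  ... | inj₂ found with i , mi ← anyF-witness _ found = inj₂ i , mi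

  unswapped : swapped ≡ false → ∀ α → mismatched α ≡ false
  unswapped sw α = ¬true⇒false (λ mα → true≢false (∨-intro (witness α mα)) sw)
    where
    witness : ∀ α → mismatched α ≡ true →
      anyF (λ t → mismatched (inj₁ t)) ≡ true ⊎ anyF (λ i → mismatched (inj₂ i)) ≡ true
    witness (inj₁ t) mα = inj₁ (anyF-intro _ t mα)
    witness (inj₂ i) mα = inj₂ (anyF-intro _ i mα)

  unseparated : ∀ α → separates α ≡ false → b α ≡ a α × a' α ≡ a α × b' α ≡ a α
  unseparated α not-sep =
    b≡a , ∨∧-equal-pair {a α} (subst (λ z → (a α ∨ z) ≡ _) b≡a (proj₁ (same-pair α)))
                              (subst (λ z → (a α ∧ z) ≡ _) b≡a (proj₂ (same-pair α)))
    where b≡a = xor-false {a α} not-sep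

  separated-swapped : ∀ α → swapped ≡ true → separates α ≡ true → a' α ≡ b α × b' α ≡ a α
  separated-swapped α sw sep
    with γ , mis-γ ← swapped-witness sw
    with sep-γ , flipped-γ ← ∧-elim mis-γ
    = swap-propagates sep (proj₁ (same-pair α)) (proj₂ (same-pair α))
                      sep-γ (proj₁ (same-pair γ)) (proj₂ (same-pair γ)) flipped-γ (overlaps α γ)

  separated-unswapped : ∀ α → swapped ≡ false → separates α ≡ true → a' α ≡ a α × b' α ≡ b α
  separated-unswapped α sw sep
    with b≡¬a , b'≡¬a' ← ∨∧-split-pair {a α} {b α} {a' α} {b' α} sep
                                       (proj₁ (same-pair α)) (proj₂ (same-pair α))
    = a'≡a , trans b'≡¬a' (trans (cong not a'≡a) (sym b≡¬a))
    where
    a'≡a : a' α ≡ a α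
    a'≡a = xor-false (subst (λ z → (z ∧ (a α xor a' α)) ≡ false) sep (unswapped sw α))

  endpoints-match : ∀ α → (if swapped then b' α else a' α) ≡ a α × (if swapped then a' α else b' α) ≡ b α
  endpoints-match α with swapped in sw | true⊎false (separates α)
  ... | true  | inj₁ sep = swap (separated-swapped α sw sep)
  ... | false | inj₁ sep = separated-unswapped α sw sep
  ... | true  | inj₂ not-sep with b≡a , a'≡a , b'≡a ← unseparated α not-sep = b'≡a , trans a'≡a (sym b≡a)
  ... | false | inj₂ not-sep with b≡a , a'≡a , b'≡a ← unseparated α not-sep = a'≡a , trans b'≡a (sym b≡a)

-- Reconstruction across a contracted edge

module NonLoopCase {g n p : ℕ} {G G' : Pair n (suc p)} {S : IsStablePair g G} {S' : IsStablePair g G'}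
  {j : Fin (suc p)} (X : NonLoopHalf G S j) (X' : NonLoopHalf G' S' j)
  (ι : Contraction.C X ≅ Contraction.C X') (𝒬≡ : ∀ α γ → 𝒬 G α γ ≡ 𝒬 G' α γ) where

  private
    module A = Contraction X
    module B = Contraction X'
    module KA = Kinds A.C
    module KB = Kinds B.C
    E = ≅⇒Embedding ι
    E⁻ = ≅⇒Embedding⁻ ι (λ px → KA.V⇒Pr (A.VC-r px)) A.PrC-m
    module MF = ContractionMap X X' E
    module MB = ContractionMap X' X E⁻
  open A using (u; v; Off)
  open B using () renaming (u to u'; v to v'; Off to Off')
  open Embedding E using () renaming (f to φ; f-injective to φ-injective; f-V to φ-VC)
  open Embedding E⁻ using () renaming (f to ψ; f-V to ψ-VC)

  ψφ : ∀ {x} → A.PrC x → ψ (φ x) ≡ x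
  ψφ px = _≅_.ψφ ι _ (≡true⇒T px)

  φψ : ∀ {y} → B.PrC y → φ (ψ y) ≡ y
  φψ py = _≅_.φψ ι _ (≡true⇒T py)

  VC-u : A.VC u
  VC-u = A.VC-intro A.V-u A.u≢v

  VC-u' : B.VC u'
  VC-u' = B.VC-intro B.V-u B.u≢v

  VC-φu : B.VC (φ u)
  VC-φu = φ-VC VC-u

  -- φ need not send the merged vertex u to the merged vertex u'; among the vertices off {u, v},
  -- the one with φ y = u' is therefore sent to φ u instead.
  exchange unexchange : Fin B.N → Fin B.N
  exchange y' = if y' == u' then φ u else y'
  unexchange y' = if y' == φ u then u' else y'

  β₀ : Fin A.N → Fin B.N
  β₀ y = exchange (φ y)

  β₀⁻ : Fin B.N → Fin A.N
  β₀⁻ y' = ψ (unexchange y')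

  φ-off : ∀ {y} → Off y → ¬ φ y ≡ φ u
  φ-off (vy , y≢u , y≢v) e = y≢u (φ-injective (KA.V⇒Pr (A.VC-intro vy y≢v)) (KA.V⇒Pr VC-u) e)

  Off-β₀ : ∀ {y} → Off y → Off' (β₀ y)
  Off-β₀ {y} off@(vy , y≢u , y≢v) with φ y ≟ u'
  ... | yes φy≡u' =
    proj₁ (B.VC-elim VC-φu) , (λ φu≡u' → φ-off off (trans φy≡u' (sym φu≡u'))) , proj₂ (B.VC-elim VC-φu)
  ... | no φy≢u' =
    proj₁ (B.VC-elim VC-φy) , φy≢u' , proj₂ (B.VC-elim VC-φy)
    where VC-φy = φ-VC (A.VC-intro vy y≢v)

  β₀⁻∘β₀ : ∀ {y} → Off y → β₀⁻ (β₀ y) ≡ y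
  β₀⁻∘β₀ {y} off@(vy , y≢u , y≢v) with φ y ≟ u'
  ... | yes φy≡u' rewrite if-==-here {x = φ u} {p = u'} {q = φ u} refl =
    trans (cong ψ (sym φy≡u')) (ψφ (KA.V⇒Pr (A.VC-intro vy y≢v)))
  ... | no φy≢u' rewrite if-==-there {p = u'} {q = φ y} (φ-off off) =
    ψφ (KA.V⇒Pr (A.VC-intro vy y≢v))

  private
    VC-unexchange : ∀ {y'} → Off' y' → B.VC (unexchange y')
    VC-unexchange {y'} (vy' , _ , y'≢v') with y' ≟ φ u
    ... | yes y'≡φu = VC-u'
    ... | no y'≢φu = B.VC-intro vy' y'≢v'

    φβ₀⁻ : ∀ {y'} → Off' y' → φ (β₀⁻ y') ≡ unexchange y'
    φβ₀⁻ off' = φψ (KB.V⇒Pr (VC-unexchange off'))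

  Off-β₀⁻ : ∀ {y'} → Off' y' → Off (β₀⁻ y')
  Off-β₀⁻ {y'} off'@(_ , y'≢u' , _) =
    proj₁ (A.VC-elim VC-β₀⁻) , β₀⁻≢u , proj₂ (A.VC-elim VC-β₀⁻)
    where
    VC-β₀⁻ = ψ-VC (VC-unexchange off')
    β₀⁻≢u : ¬ β₀⁻ y' ≡ u
    β₀⁻≢u e with y' ≟ φ u | trans (sym (φβ₀⁻ off')) (cong φ e)
    ... | yes y'≡φu | unexch≡φu rewrite if-==-here {p = u'} {q = y'} y'≡φu =
      y'≢u' (trans y'≡φu (sym unexch≡φu))
    ... | no y'≢φu | unexch≡φu rewrite if-==-there {p = u'} {q = y'} y'≢φu = y'≢φu unexch≡φu

  β₀∘β₀⁻ : ∀ {y'} → Off' y' → β₀ (β₀⁻ y') ≡ y'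
  β₀∘β₀⁻ {y'} off'@(_ , y'≢u' , _) rewrite φβ₀⁻ off' with y' ≟ φ u
  ... | yes y'≡φu rewrite if-==-here {x = u'} {p = φ u} {q = u'} refl = sym y'≡φu
  ... | no y'≢φu rewrite if-==-there {p = φ u} {q = y'} y'≢u' = refl

  IncC⇔IncC-φ : ∀ α → ¬ α ≡ A.e → ∀ {z} → A.VC z → A.IncC α z ⇔ B.IncC α (φ z)
  IncC⇔IncC-φ α α≢e vz = mk⇔ (MF.f-IncC α α≢e vz)
    (λ inc → subst (A.IncC α) (ψφ (KA.V⇒Pr vz)) (MB.f-IncC α α≢e (φ-VC vz) inc))

  -- Row e of 𝒬 sees exactly which objects meet {u, v}, and these are the objects meeting the
  -- merged vertex of the contraction.
  merged⇔merged : ∀ α → A.IncC α u ⇔ B.IncC α u'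
  merged⇔merged α = ⇔-trans (⇔-sym (A.Inc⇔IncC-merged α)) (⇔-trans row (B.Inc⇔IncC-merged α))
    where
    same-∨ : (incident G α u ∨ incident G α v) ≡ (incident G' α u' ∨ incident G' α v')
    same-∨ = proj₁ (ind+ind-injective (incident G α u) (incident G α v) (incident G' α u') (incident G' α v')
      (trans (sym (A.𝒬-row-e α)) (trans (𝒬≡ A.e α) (B.𝒬-row-e α))))
    row : (A.Inc α u ⊎ A.Inc α v) ⇔ (B.Inc α u' ⊎ B.Inc α v')
    row = mk⇔ (λ inc → ∨-elim (trans (sym same-∨) (∨-intro inc)))
              (λ inc → ∨-elim (trans same-∨ (∨-intro inc)))

  Inc⇔Inc-β₀ : ∀ α → ¬ α ≡ A.e → ∀ {y} → Off y → A.Inc α y ⇔ B.Inc α (β₀ y)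
  Inc⇔Inc-β₀ α α≢e {y} off@(vy , y≢u , y≢v) with φ y ≟ u'
  ... | yes φy≡u' =
    ⇔-trans (A.Inc⇔IncC-away α y≢u y≢v)
   (⇔-trans (IncC⇔IncC-φ α α≢e vCy)
   (⇔-trans (subst (λ z → B.IncC α (φ y) ⇔ B.IncC α z) φy≡u' ⇔-refl)
   (⇔-trans (⇔-sym (merged⇔merged α))
   (⇔-trans (IncC⇔IncC-φ α α≢e VC-u)
            (⇔-sym (B.Inc⇔IncC-away α φu≢u' (proj₂ (B.VC-elim VC-φu))))))))
    where
    vCy = A.VC-intro vy y≢v
    φu≢u' : ¬ φ u ≡ u'
    φu≢u' φu≡u' = φ-off off (trans φy≡u' (sym φu≡u'))
  ... | no φy≢u' =
    ⇔-trans (A.Inc⇔IncC-away α y≢u y≢v)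
   (⇔-trans (IncC⇔IncC-φ α α≢e vCy)
            (⇔-sym (B.Inc⇔IncC-away α φy≢u' (proj₂ (B.VC-elim (φ-VC vCy))))))
    where vCy = A.VC-intro vy y≢v

  incident-β₀ : ∀ α {y} → Off y → incident G' α (β₀ y) ≡ incident G α y
  incident-β₀ α {y} off@(_ , y≢u , y≢v) with ≡-dec _≟_ _≟_ α A.e
  ... | no α≢e = ⇔→≡ {z = true} (⇔-sym (Inc⇔Inc-β₀ α α≢e off))
  ... | yes refl = trans (¬true⇒false (λ inc → [ β₀y≢u' , β₀y≢v' ] (B.Inc-e inc)))
                         (sym (¬true⇒false (λ inc → [ y≢u , y≢v ] (A.Inc-e inc))))
    where
    β₀y≢u' = proj₁ (proj₂ (Off-β₀ off))
    β₀y≢v' = proj₂ (proj₂ (Off-β₀ off))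

  sharedOff-count : ∀ α γ → countF (A.sharedOff α γ) ≡ countF (B.sharedOff α γ)
  sharedOff-count α γ = countF-≡-bij _ _ β₀ β₀⁻ to from
    (λ _ sh → β₀⁻∘β₀ (proj₁ (A.sharedOff-elim α γ sh)))
    (λ _ sh → β₀∘β₀⁻ (proj₁ (B.sharedOff-elim α γ sh)))
    where
    to : ∀ y → A.sharedOff α γ y ≡ true → B.sharedOff α γ (β₀ y) ≡ true
    to y sh with off , incα , incγ ← A.sharedOff-elim α γ sh =
      B.sharedOff-intro α γ (Off-β₀ off) (trans (incident-β₀ α off) incα) (trans (incident-β₀ γ off) incγ)
    back : ∀ δ {y'} → Off' y' → B.Inc δ y' → A.Inc δ (β₀⁻ y')
    back δ off' inc =
      trans (sym (incident-β₀ δ (Off-β₀⁻ off'))) (trans (cong (incident G' δ) (β₀∘β₀⁻ off')) inc)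
    from : ∀ y' → B.sharedOff α γ y' ≡ true → A.sharedOff α γ (β₀⁻ y') ≡ true
    from y' sh with off' , incα , incγ ← B.sharedOff-elim α γ sh =
      A.sharedOff-intro α γ (Off-β₀⁻ off') (back α off' incα) (back γ off' incγ)

  iu iv iu' iv' : Fin (suc p) ⊎ Fin n → Bool
  iu α = incident G α u
  iv α = incident G α v
  iu' α = incident G' α u'
  iv' α = incident G' α v'

  𝒬-endpoints : ∀ α γ →
    ind (iu α ∧ iu γ) + ind (iv α ∧ iv γ) ≡ ind (iu' α ∧ iu' γ) + ind (iv' α ∧ iv' γ)
  𝒬-endpoints α γ = ℕₚ.+-cancelʳ-≡ _ _ _ (begin
    ind (iu α ∧ iu γ) + ind (iv α ∧ iv γ) + countF (B.sharedOff α γ)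
      ≡⟨ ℕₚ.+-assoc (ind (iu α ∧ iu γ)) _ _ ⟩
    ind (iu α ∧ iu γ) + (ind (iv α ∧ iv γ) + countF (B.sharedOff α γ))
      ≡⟨ cong (λ c → ind (iu α ∧ iu γ) + (ind (iv α ∧ iv γ) + c)) (sym (sharedOff-count α γ)) ⟩
    ind (iu α ∧ iu γ) + (ind (iv α ∧ iv γ) + countF (A.sharedOff α γ))
      ≡⟨ sym (A.𝒬-split α γ) ⟩
    𝒬 G α γ
      ≡⟨ 𝒬≡ α γ ⟩
    𝒬 G' α γ
      ≡⟨ B.𝒬-split α γ ⟩
    ind (iu' α ∧ iu' γ) + (ind (iv' α ∧ iv' γ) + countF (B.sharedOff α γ))
      ≡⟨ sym (ℕₚ.+-assoc (ind (iu' α ∧ iu' γ)) _ _) ⟩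
    ind (iu' α ∧ iu' γ) + ind (iv' α ∧ iv' γ) + countF (B.sharedOff α γ) ∎)
    where open ≡-Reasoning

  module Assemble (bu bv : Fin B.N) (ends : (bu ≡ u' × bv ≡ v') ⊎ (bu ≡ v' × bv ≡ u'))
    (incident-bu : ∀ α → incident G' α bu ≡ iu α) (incident-bv : ∀ α → incident G' α bv ≡ iv α) where

    β : Fin A.N → Fin B.N
    β y = if y == u then bu else if y == v then bv else β₀ y

    β⁻ : Fin B.N → Fin A.N
    β⁻ y' = if y' == bu then u else if y' == bv then v else β₀⁻ y'

    bu≢bv : ¬ bu ≡ bv
    bu≢bv = [ (λ (bu≡u' , bv≡v') e → B.u≢v (trans (sym bu≡u') (trans e bv≡v')))
            , (λ (bu≡v' , bv≡u') e → B.u≢v (trans (sym bv≡u') (trans (sym e) bu≡v'))) ] ends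

    V-bu : B.V bu
    V-bu = [ (λ (bu≡u' , _) → subst B.V (sym bu≡u') B.V-u)
           , (λ (bu≡v' , _) → subst B.V (sym bu≡v') B.V-v) ] ends

    V-bv : B.V bv
    V-bv = [ (λ (_ , bv≡v') → subst B.V (sym bv≡v') B.V-v)
           , (λ (_ , bv≡u') → subst B.V (sym bv≡u') B.V-u) ] ends

    V'-cases : ∀ {y'} → B.V y' → y' ≡ bu ⊎ y' ≡ bv ⊎ Off' y'
    V'-cases vy' = classify (B.V-cases vy') ends
      where
      classify : ∀ {y'} → y' ≡ u' ⊎ y' ≡ v' ⊎ Off' y' → (bu ≡ u' × bv ≡ v') ⊎ (bu ≡ v' × bv ≡ u') →
                 y' ≡ bu ⊎ y' ≡ bv ⊎ Off' y'
      classify (inj₁ y'≡u') (inj₁ (bu≡u' , _)) = inj₁ (trans y'≡u' (sym bu≡u'))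
      classify (inj₁ y'≡u') (inj₂ (_ , bv≡u')) = inj₂ (inj₁ (trans y'≡u' (sym bv≡u')))
      classify (inj₂ (inj₁ y'≡v')) (inj₁ (_ , bv≡v')) = inj₂ (inj₁ (trans y'≡v' (sym bv≡v')))
      classify (inj₂ (inj₁ y'≡v')) (inj₂ (bu≡v' , _)) = inj₁ (trans y'≡v' (sym bu≡v'))
      classify (inj₂ (inj₂ off')) _ = inj₂ (inj₂ off')

    Off'⇒≢ends : ∀ {y'} → Off' y' → ¬ y' ≡ bu × ¬ y' ≡ bv
    Off'⇒≢ends (_ , y'≢u' , y'≢v') =
      [ (λ (bu≡u' , bv≡v') → (λ e → y'≢u' (trans e bu≡u')) , (λ e → y'≢v' (trans e bv≡v')))
      , (λ (bu≡v' , bv≡u') → (λ e → y'≢v' (trans e bu≡v')) , (λ e → y'≢u' (trans e bv≡u'))) ] ends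

    β-u : β u ≡ bu
    β-u = if-==-here {x = u} refl

    β-v : β v ≡ bv
    β-v = trans (if-==-there (λ e → A.u≢v (sym e))) (if-==-here {x = v} refl)

    β-off : ∀ {y} → Off y → β y ≡ β₀ y
    β-off (_ , y≢u , y≢v) = trans (if-==-there y≢u) (if-==-there y≢v)

    β⁻-bu : β⁻ bu ≡ u
    β⁻-bu = if-==-here {x = bu} refl

    β⁻-bv : β⁻ bv ≡ v
    β⁻-bv = trans (if-==-there (λ e → bu≢bv (sym e))) (if-==-here {x = bv} refl)

    β⁻-off : ∀ {y'} → Off' y' → β⁻ y' ≡ β₀⁻ y'
    β⁻-off off' = trans (if-==-there (proj₁ (Off'⇒≢ends off'))) (if-==-there (proj₂ (Off'⇒≢ends off')))

    correspondence : VertexCorrespondence G G'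
    correspondence = record
      { β = β ; β⁻ = β⁻ ; β-V = β-V ; β⁻-V = β⁻-V
      ; β⁻∘β = β⁻∘β ; β∘β⁻ = β∘β⁻ ; β-incident = β-incident }
      where
      β-V : ∀ {y} → A.V y → B.V (β y)
      β-V vy with A.V-cases vy
      ... | inj₁ refl = subst B.V (sym β-u) V-bu
      ... | inj₂ (inj₁ refl) = subst B.V (sym β-v) V-bv
      ... | inj₂ (inj₂ off) = subst B.V (sym (β-off off)) (proj₁ (Off-β₀ off))
      β⁻-V : ∀ {y'} → B.V y' → A.V (β⁻ y')
      β⁻-V vy' with V'-cases vy'
      ... | inj₁ refl = subst A.V (sym β⁻-bu) A.V-u
      ... | inj₂ (inj₁ refl) = subst A.V (sym β⁻-bv) A.V-v
      ... | inj₂ (inj₂ off') = subst A.V (sym (β⁻-off off')) (proj₁ (Off-β₀⁻ off'))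
      β⁻∘β : ∀ {y} → A.V y → β⁻ (β y) ≡ y
      β⁻∘β vy with A.V-cases vy
      ... | inj₁ refl = trans (cong β⁻ β-u) β⁻-bu
      ... | inj₂ (inj₁ refl) = trans (cong β⁻ β-v) β⁻-bv
      ... | inj₂ (inj₂ off) = trans (cong β⁻ (β-off off)) (trans (β⁻-off (Off-β₀ off)) (β₀⁻∘β₀ off))
      β∘β⁻ : ∀ {y'} → B.V y' → β (β⁻ y') ≡ y'
      β∘β⁻ vy' with V'-cases vy'
      ... | inj₁ refl = trans (cong β β⁻-bu) β-u
      ... | inj₂ (inj₁ refl) = trans (cong β β⁻-bv) β-v
      ... | inj₂ (inj₂ off') = trans (cong β (β⁻-off off')) (trans (β-off (Off-β₀⁻ off')) (β₀∘β₀⁻ off'))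
      β-incident : ∀ α {y} → A.V y → incident G' α (β y) ≡ incident G α y
      β-incident α vy with A.V-cases vy
      ... | inj₁ refl = trans (cong (incident G' α) β-u) (incident-bu α)
      ... | inj₂ (inj₁ refl) = trans (cong (incident G' α) β-v) (incident-bv α)
      ... | inj₂ (inj₂ off) = trans (cong (incident G' α) (β-off off)) (incident-β₀ α off)

  private
    module Swap = EndpointSwap iu iv iu' iv' 𝒬-endpoints

  isomorphic : b1 G ≡ + g → G ≅ G'
  isomorphic = ≅-from-correspondence S S'
    (Assemble.correspondence (if Swap.swapped then v' else u') (if Swap.swapped then u' else v')
      (if-exchange Swap.swapped u' v')
      (λ α → trans (if-float (incident G' α) Swap.swapped) (proj₁ (Swap.endpoints-match α)))
      (λ α → trans (if-float (incident G' α) Swap.swapped) (proj₂ (Swap.endpoints-match α))))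
    (λ t → 𝒬≡ (inj₁ t) (inj₁ t))

-- Graphs with only loops

module AllLoops {g n p : ℕ} {G : Pair n (suc p)} (S : IsStablePair g G) (loops : Graph.OnlyLoops G S) where

  open Graph G S
  open Pair G
  open IsStablePair S using (connected)

  hub : Fin N
  hub = r (proj₁ (halfLabelled zero))

  V-hub : V hub
  V-hub = V-r (H⇒Pr (proj₁ (proj₂ (halfLabelled zero))))

  step-r : ∀ {x y} → Step G x y → Pr y × r y ≡ r x
  step-r (px , inj₁ refl) = T⇒≡true (IsStablePair.r-closed S _ px) , IsStablePair.r-idem S _ px
  step-r {x} (px , inj₂ refl) with Pr⇒V⊎H (T⇒≡true px)
  ... | inj₁ vx = Pr-s (T⇒≡true px) , cong r (V⇒s-fixed vx)
  ... | inj₂ hx = Pr-s (T⇒≡true px) , sym (loops hx)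

  path-r : ∀ {x z} → EqClosure (Step G) x z → Pr x → r x ≡ r z
  path-r ε _ = refl
  path-r (fwd st ◅ rest) _ with py , ry≡rx ← step-r st = trans (sym ry≡rx) (path-r rest py)
  path-r (bwd st ◅ rest) _ = trans (proj₂ (step-r st)) (path-r rest (T⇒≡true (proj₁ st)))

  V⇒≡hub : ∀ {y} → V y → y ≡ hub
  V⇒≡hub {y} vy = begin
    y      ≡⟨ sym (proj₂ (V-elim vy)) ⟩
    r y    ≡⟨ path-r (connected y hub (≡true⇒T (V⇒Pr vy)) (≡true⇒T (V⇒Pr V-hub))) (V⇒Pr vy) ⟩
    r hub  ≡⟨ proj₂ (V-elim V-hub) ⟩
    hub    ∎
    where open ≡-Reasoning

  incident-hub : ∀ α → incident G α hub ≡ true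
  incident-hub (inj₁ t) with b , hb , τb ← halfLabelled t = Inc₁-intro t (b , hb , τb , V⇒≡hub (V-r (H⇒Pr hb)))
  incident-hub (inj₂ i) = Inc₂-intro (V⇒≡hub (V-m i))

module _ {g n p : ℕ} {G G' : Pair n (suc p)} (S : IsStablePair g G) (S' : IsStablePair g G') where

  all-loops-correspondence : Graph.OnlyLoops G S → Graph.OnlyLoops G' S' → VertexCorrespondence G G'
  all-loops-correspondence loops loops' = record
    { β = λ _ → B.hub ; β⁻ = λ _ → A.hub ; β-V = λ _ → B.V-hub ; β⁻-V = λ _ → A.V-hub
    ; β⁻∘β = λ vx → sym (A.V⇒≡hub vx) ; β∘β⁻ = λ vy → sym (B.V⇒≡hub vy)
    ; β-incident = λ α vx → trans (B.incident-hub α)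
        (sym (subst (λ z → incident G α z ≡ true) (sym (A.V⇒≡hub vx)) (A.incident-hub α)))
    }
    where
    module A = AllLoops S loops
    module B = AllLoops S' loops'

  OnlyLoops-transfer : DeckEquiv G G' → Graph.OnlyLoops G S → Graph.OnlyLoops G' S'
  OnlyLoops-transfer deck loops {x} hx with Pair.r G' x ≟ Pair.r G' (Pair.s G' x)
  ... | yes loop = loop
  ... | no nonloop
    with _ , hy , _ , nonloop-G ← proj₁ (proj₂ (deck _)) (Graph.NonLoop-labelOf G' S' hx nonloop)
    = ⊥-elim (nonloop-G (loops (T⇒≡true hy)))

proposition4p7 : (g n : ℕ) → 3 < 3 * g + n → (p : ℕ)
    → (G G' : Pair n (suc p))
    → IsStablePair g G → b1 G ≡ + g
    → IsStablePair g G'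
    → DeckEquiv G G'
    → (∀ α β → 𝒬 G α β ≡ 𝒬 G' α β)
    → G ≅ G'
proposition4p7 g n _ p G G' S b1≡g S' deck 𝒬≡ with Graph.OnlyLoops⊎NonLoop G S
... | inj₂ (j , nonloop) = NonLoopCase.isomorphic X X' ι 𝒬≡ b1≡g
  where
  nonloop' = proj₁ (deck j) nonloop
  X = NonLoop⇒NonLoopHalf S nonloop
  X' = NonLoop⇒NonLoopHalf S' nonloop'
  ι = subst₂ _≅_ (Contraction.contract≡ X) (Contraction.contract≡ X') (proj₂ (proj₂ (deck j)) nonloop)
... | inj₁ loops = ≅-from-correspondence S S'
  (all-loops-correspondence S S' loops (OnlyLoops-transfer S S' deck loops))
  (λ t → 𝒬≡ (inj₁ t) (inj₁ t)) b1≡g
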